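{- There is a quadratic bound such that every normal cut-free derivation in $\boldsymbol{!}_\mathbf{b}\mathbf{L}^{\mathbf{1}}$ (formulated with $(\mathrm{perm})^*$) of a sequent that obeys the bracket non-negative condition has a number of rule applications bounded by a quadratic function of the size of its goal sequent.
   Context: The calculus $\boldsymbol{!}_\mathbf{b}\mathbf{L}^{\mathbf{1}}$: formulae are built from variables $p_1,p_2,\dots$ and the constant $\mathbf{1}$ using binary $\backslash$, $/$, $\cdot$ and unary $\langle\rangle$, $[]^{ -1}$, $!$. Meta-formulae are finite (possibly empty, empty one denoted $\Lambda$) sequences whose elements are formulae or bracketed meta-formulae $[\Pi]$; comma is concatenation; $\Delta(\Gamma)$ denotes $\Delta$ with a designated occurrence of a meta-formula $\Gamma$. Sequents are $\Pi\to A$; the size of a sequent is its number of symbol occurrences. Axioms: $A\to A$, $\Lambda\to\mathbf{1}$. Rules (premises $\Rightarrow$ conclusion): $(/\to)$: $\Gamma\to B$, $\Delta(C)\to D$ $\Rightarrow$ $\Delta(C/B,\Gamma)\to D$; $(\to/)$: $\Gamma,B\to C$ $\Rightarrow$ $\Gamma\to C/B$; $(\backslash\to)$: $\Gamma\to A$, $\Delta(C)\to D$ $\Rightarrow$ $\Delta(\Gamma,A\backslash C)\to D$; $(\to\backslash)$: $A,\Gamma\to C$ $\Rightarrow$ $\Gamma\to A\backslash C$; $(\cdot\to)$: $\Delta(A,B)\to D$ $\Rightarrow$ $\Delta(A\cdot B)\to D$; $(\to\cdot)$: $\Gamma_1\to A$, $\Gamma_2\to B$ $\Rightarrow$ $\Gamma_1,\Gamma_2\to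 A\cdot B$; $(\mathbf{1}\to)$: $\Delta(\Lambda)\to A$ $\Rightarrow$ $\Delta(\mathbf{1})\to A$; $(\langle\rangle\to)$: $\Delta([A])\to C$ $\Rightarrow$ $\Delta(\langle\rangle A)\to C$; $(\to\langle\rangle)$: $\Pi\to A$ $\Rightarrow$ $[\Pi]\to\langle\rangle A$; $([]^{ -1}\to)$: $\Delta(A)\to C$ $\Rightarrow$ $\Delta([[]^{ -1}A])\to C$; $(\to[]^{ -1})$: $[\Pi]\to A$ $\Rightarrow$ $\Pi\to[]^{ -1}A$; $(!\to)$: $\Gamma(A)\to B$ $\Rightarrow$ $\Gamma(!A)\to B$; $(\to!)$: $!A_1,\dots,!A_n\to A$ $\Rightarrow$ $!A_1,\dots,!A_n\to!A$; $(\mathrm{contr}_\mathbf{b})$: $\Delta(!A_1,\dots,!A_n,[!A_1,\dots,!A_n,\Gamma])\to B$ $\Rightarrow$ $\Delta(!A_1,\dots,!A_n,\Gamma)\to B$ ($n\ge1$); $(\mathrm{cut})$: $\Pi\to A$, $\Delta(A)\to C$ $\Rightarrow$ $\Delta(\Pi)\to C$. Instead of the two permutation rules $\Delta(!A,\Gamma)\to B\Rightarrow\Delta(\Gamma,!A)\to B$ and $\Delta(\Gamma,!A)\to B\Rightarrow\Delta(!A,\Gamma)\to B$, the calculus here uses the generalised permutation rule $(\mathrm{perm})^*$: from $\Delta_0,!A_1,\Delta_1,!A_2,\Delta_2,\dots,\Delta_{k-1},!A_k,\Delta_k\to C$ infer $\Delta_0,!A_{i_1},\Delta_1,!A_{i_2},\Delta_2,\dots,\Delta_{k-1},!A_{i_k},\Delta_k\to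 C$, where $\{i_1,\dots,i_k\}=\{1,\dots,k\}$ (the $!$-formulae are permuted among the slots between the fixed meta-formulae $\Delta_0,\dots,\Delta_k$; this is understood within any surrounding context). A derivation is normal if it contains no two consecutive applications of $(\mathrm{perm})^*$ (no application of $(\mathrm{perm})^*$ whose premise is the conclusion of another application of $(\mathrm{perm})^*$). Polarity: every formula occurs positively in itself; an occurrence positive (resp. negative) in $B$ is positive (resp. negative) in $A\backslash B$, $B/A$, $A\cdot B$, $B\cdot A$, $\langle\rangle B$, $[]^{ -1}B$, $!B$; an occurrence positive (resp. negative) in $A$ is negative (resp. positive) in $A\backslash B$ and $B/A$; in $\Gamma\to B$, occurrences in $B$ keep polarity and occurrences in formulae of $\Gamma$ are inverted. A sequent obeys the bracket non-negative condition if every negative occurrence of a subformula of the form $!A$ in it contains neither a positive occurrence of a subformula $[]^{ -1}C$ nor a negative occurrence of a subformula $\langle\rangle C$. -}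

module Defs where

open import Data.Nat using (ℕ; zero; suc; _+_; _*_; _≤_)
open import Data.Bool using (Bool; true; false; _∨_; not; T)
open import Data.List using (List; []; _∷_; _++_; map; [_])
open import Data.Product using (_×_; _,_; proj₁; proj₂)
open import Data.List.Relation.Binary.Permutation.Propositional using (_↭_)
open import Relation.Binary.PropositionalEquality using (_≡_)

data Fm : Set where
  var  : ℕ → Fm
  one  : Fm
  ldiv : Fm → Fm → Fm
  rdiv : Fm → Fm → Fm    -- rdiv B A  =  B / A
  prod : Fm → Fm → Fm
  dia  : Fm → Fm
  box  : Fm → Fm         -- []^{-1} A
  bang : Fm → Fm

data El : Set where
  fm : Fm → El
  br : List El → El

MF : Set
MF = List El

data Ctx : Set where
  top  : MF → MF → Ctx
  nest : MF → Ctx → MF → Ctx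

plug : Ctx → MF → MF
plug (top L R)    Γ = L ++ Γ ++ R
plug (nest L C R) Γ = L ++ br (plug C Γ) ∷ R

bangs : List Fm → MF
bangs []       = []
bangs (A ∷ As) = fm (bang A) ∷ bangs As

weave : MF → List (Fm × MF) → MF
weave Δ₀ []             = Δ₀
weave Δ₀ ((A , Δ) ∷ ps) = Δ₀ ++ fm (bang A) ∷ weave Δ ps

data Seq : Set where
  _⇒_ : MF → Fm → Seq

infix 4 _⇒_

data Deriv : Seq → Set where
  ax     : (A : Fm) → Deriv ([ fm A ] ⇒ A)
  ax1    : Deriv ([] ⇒ one)
  rdivL  : (Γ : MF) (B : Fm) (Δ : Ctx) (C D : Fm) →
           Deriv (Γ ⇒ B) → Deriv (plug Δ [ fm C ] ⇒ D) →
           Deriv (plug Δ (fm (rdiv C B) ∷ Γ) ⇒ D)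
  rdivR  : (Γ : MF) (B C : Fm) →
           Deriv (Γ ++ [ fm B ] ⇒ C) → Deriv (Γ ⇒ rdiv C B)
  ldivL  : (Γ : MF) (A : Fm) (Δ : Ctx) (C D : Fm) →
           Deriv (Γ ⇒ A) → Deriv (plug Δ [ fm C ] ⇒ D) →
           Deriv (plug Δ (Γ ++ [ fm (ldiv A C) ]) ⇒ D)
  ldivR  : (Γ : MF) (A C : Fm) →
           Deriv (fm A ∷ Γ ⇒ C) → Deriv (Γ ⇒ ldiv A C)
  prodL  : (Δ : Ctx) (A B D : Fm) →
           Deriv (plug Δ (fm A ∷ fm B ∷ []) ⇒ D) → Deriv (plug Δ [ fm (prod A B) ] ⇒ D)
  prodR  : (Γ₁ Γ₂ : MF) (A B : Fm) →
           Deriv (Γ₁ ⇒ A) → Deriv (Γ₂ ⇒ B) → Deriv (Γ₁ ++ Γ₂ ⇒ prod A B)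
  oneL   : (Δ : Ctx) (A : Fm) →
           Deriv (plug Δ [] ⇒ A) → Deriv (plug Δ [ fm one ] ⇒ A)
  diaL   : (Δ : Ctx) (A C : Fm) →
           Deriv (plug Δ [ br [ fm A ] ] ⇒ C) → Deriv (plug Δ [ fm (dia A) ] ⇒ C)
  diaR   : (Π : MF) (A : Fm) →
           Deriv (Π ⇒ A) → Deriv ([ br Π ] ⇒ dia A)
  boxL   : (Δ : Ctx) (A C : Fm) →
           Deriv (plug Δ [ fm A ] ⇒ C) → Deriv (plug Δ [ br [ fm (box A) ] ] ⇒ C)
  boxR   : (Π : MF) (A : Fm) →
           Deriv ([ br Π ] ⇒ A) → Deriv (Π ⇒ box A)
  bangL  : (Γ : Ctx) (A B : Fm) →
           Deriv (plug Γ [ fm A ] ⇒ B) → Deriv (plug Γ [ fm (bang A) ] ⇒ B)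
  bangR  : (As : List Fm) (A : Fm) →
           Deriv (bangs As ⇒ A) → Deriv (bangs As ⇒ bang A)
  -- (contr_b) with n ≥ 1: the list of A_i is A ∷ As
  contr  : (Δ : Ctx) (A : Fm) (As : List Fm) (Γ : MF) (B : Fm) →
           Deriv (plug Δ (bangs (A ∷ As) ++ [ br (bangs (A ∷ As) ++ Γ) ]) ⇒ B) →
           Deriv (plug Δ (bangs (A ∷ As) ++ Γ) ⇒ B)
  -- (perm)*: ps lists (A_i , Δ_i); qs lists (A_{i_j} , Δ_j)
  perm   : (Ξ : Ctx) (Δ₀ : MF) (ps qs : List (Fm × MF)) (C : Fm) →
           map proj₂ qs ≡ map proj₂ ps →
           map proj₁ qs ↭ map proj₁ ps →
           Deriv (plug Ξ (weave Δ₀ ps) ⇒ C) →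
           Deriv (plug Ξ (weave Δ₀ qs) ⇒ C)
  cut    : (Π : MF) (A : Fm) (Δ : Ctx) (C : Fm) →
           Deriv (Π ⇒ A) → Deriv (plug Δ [ fm A ] ⇒ C) → Deriv (plug Δ Π ⇒ C)

CutFree : ∀ {s} → Deriv s → Bool
CutFree (ax _) = true
CutFree ax1 = true
CutFree (rdivL _ _ _ _ _ d e) = CutFree d Data.Bool.∧ CutFree e
CutFree (rdivR _ _ _ d) = CutFree d
CutFree (ldivL _ _ _ _ _ d e) = CutFree d Data.Bool.∧ CutFree e
CutFree (ldivR _ _ _ d) = CutFree d
CutFree (prodL _ _ _ _ d) = CutFree d
CutFree (prodR _ _ _ _ d e) = CutFree d Data.Bool.∧ CutFree e
CutFree (oneL _ _ d) = CutFree d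
CutFree (diaL _ _ _ d) = CutFree d
CutFree (diaR _ _ d) = CutFree d
CutFree (boxL _ _ _ d) = CutFree d
CutFree (boxR _ _ d) = CutFree d
CutFree (bangL _ _ _ d) = CutFree d
CutFree (bangR _ _ d) = CutFree d
CutFree (contr _ _ _ _ _ d) = CutFree d
CutFree (perm _ _ _ _ _ _ _ d) = CutFree d
CutFree (cut _ _ _ _ _ _) = false

isPerm : ∀ {s} → Deriv s → Bool
isPerm (perm _ _ _ _ _ _ _ _) = true
isPerm _ = false

Normal : ∀ {s} → Deriv s → Bool
Normal (ax _) = true
Normal ax1 = true
Normal (rdivL _ _ _ _ _ d e) = Normal d Data.Bool.∧ Normal e
Normal (rdivR _ _ _ d) = Normal d
Normal (ldivL _ _ _ _ _ d e) = Normal d Data.Bool.∧ Normal e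
Normal (ldivR _ _ _ d) = Normal d
Normal (prodL _ _ _ _ d) = Normal d
Normal (prodR _ _ _ _ d e) = Normal d Data.Bool.∧ Normal e
Normal (oneL _ _ d) = Normal d
Normal (diaL _ _ _ d) = Normal d
Normal (diaR _ _ d) = Normal d
Normal (boxL _ _ _ d) = Normal d
Normal (boxR _ _ d) = Normal d
Normal (bangL _ _ _ d) = Normal d
Normal (bangR _ _ d) = Normal d
Normal (contr _ _ _ _ _ d) = Normal d
Normal (perm _ _ _ _ _ _ _ d) = not (isPerm d) Data.Bool.∧ Normal d
Normal (cut _ _ _ _ d e) = Normal d Data.Bool.∧ Normal e

-- number of rule applications (axioms are not rule applications)
rules : ∀ {s} → Deriv s → ℕ
rules (ax _) = 0
rules ax1 = 0
rules (rdivL _ _ _ _ _ d e) = suc (rules d + rules e)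
rules (rdivR _ _ _ d) = suc (rules d)
rules (ldivL _ _ _ _ _ d e) = suc (rules d + rules e)
rules (ldivR _ _ _ d) = suc (rules d)
rules (prodL _ _ _ _ d) = suc (rules d)
rules (prodR _ _ _ _ d e) = suc (rules d + rules e)
rules (oneL _ _ d) = suc (rules d)
rules (diaL _ _ _ d) = suc (rules d)
rules (diaR _ _ d) = suc (rules d)
rules (boxL _ _ _ d) = suc (rules d)
rules (boxR _ _ d) = suc (rules d)
rules (bangL _ _ _ d) = suc (rules d)
rules (bangR _ _ d) = suc (rules d)
rules (contr _ _ _ _ _ d) = suc (rules d)
rules (perm _ _ _ _ _ _ _ d) = suc (rules d)
rules (cut _ _ _ _ d e) = suc (rules d + rules e)

-- Size of a sequent: number of symbol occurrences
-- (variables, 1, connectives, the two bracket symbols of each [ ], and →)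

fsize : Fm → ℕ
fsize (var _)    = 1
fsize one        = 1
fsize (ldiv A B) = suc (fsize A + fsize B)
fsize (rdiv A B) = suc (fsize A + fsize B)
fsize (prod A B) = suc (fsize A + fsize B)
fsize (dia A)    = suc (fsize A)
fsize (box A)    = suc (fsize A)
fsize (bang A)   = suc (fsize A)

mfsize : MF → ℕ
mfsize []          = 0
mfsize (fm A ∷ Π)  = fsize A + mfsize Π
mfsize (br Γ ∷ Π)  = 2 + mfsize Γ + mfsize Π

size : Seq → ℕ
size (Π ⇒ A) = mfsize Π + suc (fsize A)

-- Polarity and the bracket non-negative condition
-- (polarities of subformula occurrences are taken relative to the
--  formula in which they occur)

posBox negBox posDia negDia : Fm → Bool
posBox (var _) = false
posBox one = false
posBox (ldiv A B) = negBox A ∨ posBox B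
posBox (rdiv B A) = posBox B ∨ negBox A
posBox (prod A B) = posBox A ∨ posBox B
posBox (dia A) = posBox A
posBox (box A) = true
posBox (bang A) = posBox A
negBox (var _) = false
negBox one = false
negBox (ldiv A B) = posBox A ∨ negBox B
negBox (rdiv B A) = negBox B ∨ posBox A
negBox (prod A B) = negBox A ∨ negBox B
negBox (dia A) = negBox A
negBox (box A) = negBox A
negBox (bang A) = negBox A
posDia (var _) = false
posDia one = false
posDia (ldiv A B) = negDia A ∨ posDia B
posDia (rdiv B A) = posDia B ∨ negDia A
posDia (prod A B) = posDia A ∨ posDia B
posDia (dia A) = true
posDia (box A) = posDia A
posDia (bang A) = posDia A
negDia (var _) = false
negDia one = false
negDia (ldiv A B) = posDia A ∨ negDia B
negDia (rdiv B A) = negDia B ∨ posDia A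
negDia (prod A B) = negDia A ∨ negDia B
negDia (dia A) = negDia A
negDia (box A) = negDia A
negDia (bang A) = negDia A

badBang : Fm → Bool
badBang A = posBox (bang A) ∨ negDia (bang A)

posBad negBad : Fm → Bool
posBad (var _) = false
posBad one = false
posBad (ldiv A B) = negBad A ∨ posBad B
posBad (rdiv B A) = posBad B ∨ negBad A
posBad (prod A B) = posBad A ∨ posBad B
posBad (dia A) = posBad A
posBad (box A) = posBad A
posBad (bang A) = badBang A ∨ posBad A
negBad (var _) = false
negBad one = false
negBad (ldiv A B) = posBad A ∨ negBad B
negBad (rdiv B A) = negBad B ∨ posBad A
negBad (prod A B) = negBad A ∨ negBad B
negBad (dia A) = negBad A
negBad (box A) = negBad A
negBad (bang A) = negBad A

-- polarity is inverted for formulae in the antecedent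
antBad : MF → Bool
antBad []         = false
antBad (fm A ∷ Π) = posBad A ∨ antBad Π
antBad (br Γ ∷ Π) = antBad Γ ∨ antBad Π

BracketNonNeg : Seq → Set
BracketNonNeg (Π ⇒ A) = T (not (antBad Π ∨ negBad A))

module Submission where

-- Let K be the size of the goal sequent and c = price K = 4K + 10. Give a
-- sequent the potential: 4 per symbol, plus c per occurrence of []⁻¹ or ⟨⟩ that can later fire a
-- bracket-removing rule, minus c per bracket present. Reading a cut-free derivation upwards, each
-- rule other than (perm)* lowers the potential by at least 2: a removed bracket is prepaid by the
-- occurrence that removes it, a created one pays its price; and in a normal derivation no (perm)*
-- follows another. So there are at most (4 + c) K + 1 rule
-- applications.
-- The delicate rule is (contr_b): it copies bangs !A₁ … !Aₙ into the new bracket, and the price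
-- only covers copies of size at most K. Under the bracket non-negative condition no antecedent
-- bang has a bracket-removing occurrence, so such copies are invisible to the measure of bracket
-- contents (innerSize); the invariant Budget bounds by K the size of every level together with
-- everything (→⟨⟩) may later bring next to it, and is preserved by all rules.


open import Defs
open import Data.Bool using (Bool; true; false; _∨_; _∧_; T; if_then_else_)
open import Data.Bool.Properties using (∨-conicalˡ; ∨-conicalʳ; ∨-zeroʳ; T-∧; T-not-≡)
open import Data.List using (List; []; _∷_; _++_; map; [_]; concat)
open import Data.List.Properties using (++-identityʳ; ++-assoc)
open import Data.List.Relation.Binary.Permutation.Propositional using (_↭_)
open import Data.List.Relation.Binary.Permutation.Propositional.Properties using (map⁺)
open import Data.List.Relation.Unary.All using (All; []; _∷_)
open import Data.Nat using (ℕ; suc; _+_; _*_; _≤_; z≤n; s≤s)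
open import Data.Nat.ListAction using (sum)
open import Data.Nat.ListAction.Properties using (sum-↭)
open import Data.Nat.Properties
open import Algebra.Properties.CommutativeSemigroup +-commutativeSemigroup using (xy∙z≈xz∙y)
open import Data.Nat.Tactic.RingSolver using (solve-∀)
open import Data.Product using (Σ; ∃; _×_; _,_; proj₁; proj₂)
open import Data.Unit using (⊤; tt)
open import Function using (id)
open import Function.Bundles using (Equivalence)
open import Relation.Binary.PropositionalEquality using (_≡_; refl; sym; trans; cong; cong₂; subst; subst₂; module ≡-Reasoning)

m+k≡n⇒m≤n : ∀ {m n} k → m + k ≡ n → m ≤ n
m+k≡n⇒m≤n {m} k refl = m≤m+n m k

∨-trueˡ : ∀ {a} b → a ≡ true → a ∨ b ≡ true
∨-trueˡ b refl = refl

∨-trueʳ : ∀ a {b} → b ≡ true → a ∨ b ≡ true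
∨-trueʳ a refl = ∨-zeroʳ a

weight : (Fm → ℕ) → ℕ → MF → ℕ
weight g c []         = 0
weight g c (fm A ∷ Π) = g A + weight g c Π
weight g c (br Γ ∷ Π) = c + weight g c Γ + weight g c Π

weightᶜ : (Fm → ℕ) → ℕ → Ctx → ℕ
weightᶜ g c (top L R)    = weight g c L + weight g c R
weightᶜ g c (nest L C R) = weight g c L + (c + weightᶜ g c C + weight g c R)

module _ (g : Fm → ℕ) (c : ℕ) where

  weight-++ : ∀ L M → weight g c (L ++ M) ≡ weight g c L + weight g c M
  weight-++ []         M = refl
  weight-++ (fm A ∷ L) M = trans (cong (g A +_) (weight-++ L M)) (sym (+-assoc (g A) _ _))
  weight-++ (br Γ ∷ L) M =
    trans (cong (c + weight g c Γ +_) (weight-++ L M)) (sym (+-assoc (c + weight g c Γ) _ _))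

  weight-plug : ∀ Δ X → weight g c (plug Δ X) ≡ weightᶜ g c Δ + weight g c X
  weight-plug (top L R) X
    rewrite weight-++ L (X ++ R) | weight-++ X R = shuffle (weight g c L) (weight g c X) (weight g c R)
    where
    shuffle : ∀ l x r → l + (x + r) ≡ (l + r) + x
    shuffle = solve-∀
  weight-plug (nest L C R) X
    rewrite weight-++ L (br (plug C X) ∷ R) | weight-plug C X =
      shuffle (weight g c L) c (weightᶜ g c C) (weight g c X) (weight g c R)
    where
    shuffle : ∀ l c y x r → l + (c + (y + x) + r) ≡ (l + (c + y + r)) + x
    shuffle = solve-∀

  weight-plug-≤ : ∀ Δ {X X'} → weight g c X' ≤ weight g c X → weight g c (plug Δ X') ≤ weight g c (plug Δ X)
  weight-plug-≤ Δ {X} {X'} le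
    rewrite weight-plug Δ X' | weight-plug Δ X = +-monoʳ-≤ (weightᶜ g c Δ) le

  weight-plug-≡0 : ∀ Δ X → weight g c (plug Δ X) ≡ 0 → weightᶜ g c Δ ≡ 0 × weight g c X ≡ 0
  weight-plug-≡0 Δ X e rewrite weight-plug Δ X = m+n≡0⇒m≡0 _ e , m+n≡0⇒n≡0 _ e

  weight-plug-0 : ∀ Δ X → weightᶜ g c Δ ≡ 0 → weight g c X ≡ 0 → weight g c (plug Δ X) ≡ 0
  weight-plug-0 Δ X e₁ e₂ rewrite weight-plug Δ X | e₁ | e₂ = refl

weight-mono : ∀ {g h} c → (∀ A → g A ≤ h A) → ∀ Π → weight g c Π ≤ weight h c Π
weight-mono c le []         = z≤n
weight-mono c le (fm A ∷ Π) = +-mono-≤ (le A) (weight-mono c le Π)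
weight-mono c le (br Γ ∷ Π) = +-mono-≤ (+-monoʳ-≤ c (weight-mono c le Γ)) (weight-mono c le Π)

weight-[fm] : ∀ g c A → weight g c [ fm A ] ≡ g A
weight-[fm] g c A = +-identityʳ (g A)

weight-[fm,fm] : ∀ g c A B → weight g c (fm A ∷ fm B ∷ []) ≡ g A + g B
weight-[fm,fm] g c A B = cong (g A +_) (+-identityʳ (g B))

Additive : (MF → ℕ) → Set
Additive F = ∀ L M → F (L ++ M) ≡ F L + F M

module _ (F : MF → ℕ) (F-++ : Additive F) where

  additive-weave : ∀ Δ₀ ps → F (weave Δ₀ ps) ≡
    F Δ₀ + (sum (map (λ A → F [ fm (bang A) ]) (map proj₁ ps)) + sum (map F (map proj₂ ps)))
  additive-weave Δ₀ []             = sym (+-identityʳ (F Δ₀))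
  additive-weave Δ₀ ((A , Δ) ∷ ps)
    rewrite F-++ Δ₀ (fm (bang A) ∷ weave Δ ps) | F-++ [ fm (bang A) ] (weave Δ ps) | additive-weave Δ ps =
      shuffle (F Δ₀) (F [ fm (bang A) ]) (F Δ) _ _
    where
    shuffle : ∀ d b r s t → d + (b + (r + (s + t))) ≡ d + ((b + s) + (r + t))
    shuffle = solve-∀

  additive-perm : ∀ Δ₀ ps qs → map proj₂ qs ≡ map proj₂ ps → map proj₁ qs ↭ map proj₁ ps →
    F (weave Δ₀ qs) ≡ F (weave Δ₀ ps)
  additive-perm Δ₀ ps qs same-slots bangs↭
    rewrite additive-weave Δ₀ ps | additive-weave Δ₀ qs | same-slots
          | sum-↭ (map⁺ (λ A → F [ fm (bang A) ]) bangs↭) = refl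

-- Occurrences of []⁻¹ and ⟨⟩ that can fire a bracket-removing rule, ([]⁻¹→) or (→⟨⟩), in a
-- formula on the left (ᴸ) or on the right (ᴿ) of the arrow.
removersᴸ removersᴿ : Fm → ℕ
removersᴸ (var _)    = 0
removersᴸ one        = 0
removersᴸ (ldiv A B) = removersᴿ A + removersᴸ B
removersᴸ (rdiv B A) = removersᴸ B + removersᴿ A
removersᴸ (prod A B) = removersᴸ A + removersᴸ B
removersᴸ (dia A)    = removersᴸ A
removersᴸ (box A)    = suc (removersᴸ A)
removersᴸ (bang A)   = removersᴸ A
removersᴿ (var _)    = 0
removersᴿ one        = 0
removersᴿ (ldiv A B) = removersᴸ A + removersᴿ B
removersᴿ (rdiv B A) = removersᴿ B + removersᴸ A
removersᴿ (prod A B) = removersᴿ A + removersᴿ B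
removersᴿ (dia A)    = suc (removersᴿ A)
removersᴿ (box A)    = removersᴿ A
removersᴿ (bang A)   = removersᴿ A

-- Total size of what ([]⁻¹→) can release from a bracket out of an antecedent (ᴸ) formula.
boxBodiesᴸ boxBodiesᴿ : Fm → ℕ
boxBodiesᴸ (var _)    = 0
boxBodiesᴸ one        = 0
boxBodiesᴸ (ldiv A B) = boxBodiesᴿ A + boxBodiesᴸ B
boxBodiesᴸ (rdiv B A) = boxBodiesᴸ B + boxBodiesᴿ A
boxBodiesᴸ (prod A B) = boxBodiesᴸ A + boxBodiesᴸ B
boxBodiesᴸ (dia A)    = boxBodiesᴸ A
boxBodiesᴸ (box A)    = fsize A
boxBodiesᴸ (bang A)   = boxBodiesᴸ A
boxBodiesᴿ (var _)    = 0
boxBodiesᴿ one        = 0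
boxBodiesᴿ (ldiv A B) = boxBodiesᴸ A + boxBodiesᴿ B
boxBodiesᴿ (rdiv B A) = boxBodiesᴿ B + boxBodiesᴸ A
boxBodiesᴿ (prod A B) = boxBodiesᴿ A + boxBodiesᴿ B
boxBodiesᴿ (dia A)    = boxBodiesᴿ A
boxBodiesᴿ (box A)    = boxBodiesᴿ A
boxBodiesᴿ (bang A)   = boxBodiesᴿ A

private
  ≤-under-binary : ∀ {a b c d} → a ≤ c → b ≤ d → a + b ≤ suc (c + d)
  ≤-under-binary p q = m≤n⇒m≤1+n (+-mono-≤ p q)

removersᴸ≤fsize : ∀ A → removersᴸ A ≤ fsize A
removersᴿ≤fsize : ∀ A → removersᴿ A ≤ fsize A
removersᴸ≤fsize (var _)    = z≤n
removersᴸ≤fsize one        = z≤n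
removersᴸ≤fsize (ldiv A B) = ≤-under-binary (removersᴿ≤fsize A) (removersᴸ≤fsize B)
removersᴸ≤fsize (rdiv B A) = ≤-under-binary (removersᴸ≤fsize B) (removersᴿ≤fsize A)
removersᴸ≤fsize (prod A B) = ≤-under-binary (removersᴸ≤fsize A) (removersᴸ≤fsize B)
removersᴸ≤fsize (dia A)    = m≤n⇒m≤1+n (removersᴸ≤fsize A)
removersᴸ≤fsize (box A)    = s≤s (removersᴸ≤fsize A)
removersᴸ≤fsize (bang A)   = m≤n⇒m≤1+n (removersᴸ≤fsize A)
removersᴿ≤fsize (var _)    = z≤n
removersᴿ≤fsize one        = z≤n
removersᴿ≤fsize (ldiv A B) = ≤-under-binary (removersᴸ≤fsize A) (removersᴿ≤fsize B)
removersᴿ≤fsize (rdiv B A) = ≤-under-binary (removersᴿ≤fsize B) (removersᴸ≤fsize A)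
removersᴿ≤fsize (prod A B) = ≤-under-binary (removersᴿ≤fsize A) (removersᴿ≤fsize B)
removersᴿ≤fsize (dia A)    = s≤s (removersᴿ≤fsize A)
removersᴿ≤fsize (box A)    = m≤n⇒m≤1+n (removersᴿ≤fsize A)
removersᴿ≤fsize (bang A)   = m≤n⇒m≤1+n (removersᴿ≤fsize A)

boxBodiesᴸ≤fsize : ∀ A → boxBodiesᴸ A ≤ fsize A
boxBodiesᴿ≤fsize : ∀ A → boxBodiesᴿ A ≤ fsize A
boxBodiesᴸ≤fsize (var _)    = z≤n
boxBodiesᴸ≤fsize one        = z≤n
boxBodiesᴸ≤fsize (ldiv A B) = ≤-under-binary (boxBodiesᴿ≤fsize A) (boxBodiesᴸ≤fsize B)
boxBodiesᴸ≤fsize (rdiv B A) = ≤-under-binary (boxBodiesᴸ≤fsize B) (boxBodiesᴿ≤fsize A)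
boxBodiesᴸ≤fsize (prod A B) = ≤-under-binary (boxBodiesᴸ≤fsize A) (boxBodiesᴸ≤fsize B)
boxBodiesᴸ≤fsize (dia A)    = m≤n⇒m≤1+n (boxBodiesᴸ≤fsize A)
boxBodiesᴸ≤fsize (box A)    = n≤1+n (fsize A)
boxBodiesᴸ≤fsize (bang A)   = m≤n⇒m≤1+n (boxBodiesᴸ≤fsize A)
boxBodiesᴿ≤fsize (var _)    = z≤n
boxBodiesᴿ≤fsize one        = z≤n
boxBodiesᴿ≤fsize (ldiv A B) = ≤-under-binary (boxBodiesᴸ≤fsize A) (boxBodiesᴿ≤fsize B)
boxBodiesᴿ≤fsize (rdiv B A) = ≤-under-binary (boxBodiesᴿ≤fsize B) (boxBodiesᴸ≤fsize A)
boxBodiesᴿ≤fsize (prod A B) = ≤-under-binary (boxBodiesᴿ≤fsize A) (boxBodiesᴿ≤fsize B)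
boxBodiesᴿ≤fsize (dia A)    = m≤n⇒m≤1+n (boxBodiesᴿ≤fsize A)
boxBodiesᴿ≤fsize (box A)    = m≤n⇒m≤1+n (boxBodiesᴿ≤fsize A)
boxBodiesᴿ≤fsize (bang A)   = m≤n⇒m≤1+n (boxBodiesᴿ≤fsize A)

private
  +≡0 : ∀ {a b} → a ≡ 0 → b ≡ 0 → a + b ≡ 0
  +≡0 refl refl = refl

removersᴸ≡0 : ∀ A → posBox A ≡ false → negDia A ≡ false → removersᴸ A ≡ 0
removersᴿ≡0 : ∀ A → negBox A ≡ false → posDia A ≡ false → removersᴿ A ≡ 0
removersᴸ≡0 (var _)    p q = refl
removersᴸ≡0 one        p q = refl
removersᴸ≡0 (ldiv A B) p q =
  +≡0 (removersᴿ≡0 A (∨-conicalˡ _ _ p) (∨-conicalˡ _ _ q)) (removersᴸ≡0 B (∨-conicalʳ _ _ p) (∨-conicalʳ _ _ q))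
removersᴸ≡0 (rdiv B A) p q =
  +≡0 (removersᴸ≡0 B (∨-conicalˡ _ _ p) (∨-conicalˡ _ _ q)) (removersᴿ≡0 A (∨-conicalʳ _ _ p) (∨-conicalʳ _ _ q))
removersᴸ≡0 (prod A B) p q =
  +≡0 (removersᴸ≡0 A (∨-conicalˡ _ _ p) (∨-conicalˡ _ _ q)) (removersᴸ≡0 B (∨-conicalʳ _ _ p) (∨-conicalʳ _ _ q))
removersᴸ≡0 (dia A)    p q = removersᴸ≡0 A p q
removersᴸ≡0 (box A)    () q
removersᴸ≡0 (bang A)   p q = removersᴸ≡0 A p q
removersᴿ≡0 (var _)    p q = refl
removersᴿ≡0 one        p q = refl
removersᴿ≡0 (ldiv A B) p q =
  +≡0 (removersᴸ≡0 A (∨-conicalˡ _ _ p) (∨-conicalˡ _ _ q)) (removersᴿ≡0 B (∨-conicalʳ _ _ p) (∨-conicalʳ _ _ q))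
removersᴿ≡0 (rdiv B A) p q =
  +≡0 (removersᴿ≡0 B (∨-conicalˡ _ _ p) (∨-conicalˡ _ _ q)) (removersᴸ≡0 A (∨-conicalʳ _ _ p) (∨-conicalʳ _ _ q))
removersᴿ≡0 (prod A B) p q =
  +≡0 (removersᴿ≡0 A (∨-conicalˡ _ _ p) (∨-conicalˡ _ _ q)) (removersᴿ≡0 B (∨-conicalʳ _ _ p) (∨-conicalʳ _ _ q))
removersᴿ≡0 (dia A)    p ()
removersᴿ≡0 (box A)    p q = removersᴿ≡0 A p q
removersᴿ≡0 (bang A)   p q = removersᴿ≡0 A p q

boxBodiesᴸ≡0 : ∀ A → posBox A ≡ false → boxBodiesᴸ A ≡ 0
boxBodiesᴿ≡0 : ∀ A → negBox A ≡ false → boxBodiesᴿ A ≡ 0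
boxBodiesᴸ≡0 (var _)    p = refl
boxBodiesᴸ≡0 one        p = refl
boxBodiesᴸ≡0 (ldiv A B) p = +≡0 (boxBodiesᴿ≡0 A (∨-conicalˡ _ _ p)) (boxBodiesᴸ≡0 B (∨-conicalʳ _ _ p))
boxBodiesᴸ≡0 (rdiv B A) p = +≡0 (boxBodiesᴸ≡0 B (∨-conicalˡ _ _ p)) (boxBodiesᴿ≡0 A (∨-conicalʳ _ _ p))
boxBodiesᴸ≡0 (prod A B) p = +≡0 (boxBodiesᴸ≡0 A (∨-conicalˡ _ _ p)) (boxBodiesᴸ≡0 B (∨-conicalʳ _ _ p))
boxBodiesᴸ≡0 (dia A)    p = boxBodiesᴸ≡0 A p
boxBodiesᴸ≡0 (box A)    ()
boxBodiesᴸ≡0 (bang A)   p = boxBodiesᴸ≡0 A p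
boxBodiesᴿ≡0 (var _)    p = refl
boxBodiesᴿ≡0 one        p = refl
boxBodiesᴿ≡0 (ldiv A B) p = +≡0 (boxBodiesᴸ≡0 A (∨-conicalˡ _ _ p)) (boxBodiesᴿ≡0 B (∨-conicalʳ _ _ p))
boxBodiesᴿ≡0 (rdiv B A) p = +≡0 (boxBodiesᴿ≡0 B (∨-conicalˡ _ _ p)) (boxBodiesᴸ≡0 A (∨-conicalʳ _ _ p))
boxBodiesᴿ≡0 (prod A B) p = +≡0 (boxBodiesᴿ≡0 A (∨-conicalˡ _ _ p)) (boxBodiesᴿ≡0 B (∨-conicalʳ _ _ p))
boxBodiesᴿ≡0 (dia A)    p = boxBodiesᴿ≡0 A p
boxBodiesᴿ≡0 (box A)    p = boxBodiesᴿ≡0 A p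
boxBodiesᴿ≡0 (bang A)   p = boxBodiesᴿ≡0 A p

sizeIf : Bool → Fm → ℕ
sizeIf b A = if b then fsize A else 0

sizeIf≤fsize : ∀ b A → sizeIf b A ≤ fsize A
sizeIf≤fsize true  A = ≤-refl
sizeIf≤fsize false A = z≤n

sizeIf-mono : ∀ b b' {A F} → (b ≡ true → b' ≡ true) → fsize A ≤ fsize F → sizeIf b A ≤ sizeIf b' F
sizeIf-mono true  b' imp le rewrite imp refl = le
sizeIf-mono false b' imp le = z≤n

sizeIf-+ : ∀ b b' {A B F} → fsize A + fsize B ≤ fsize F → sizeIf b A + sizeIf b' B ≤ sizeIf (b ∨ b') F
sizeIf-+ true  b' {A} le = ≤-trans (+-monoʳ-≤ (fsize A) (sizeIf≤fsize b' _)) le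
sizeIf-+ false true  {B = B} le = ≤-trans (+-monoˡ-≤ (fsize B) z≤n) le
sizeIf-+ false false le = z≤n

sizeOrBodies : Bool → Fm → ℕ
sizeOrBodies b A = if b then fsize A else boxBodiesᴸ A

sizeOrBodies≤fsize : ∀ b A → sizeOrBodies b A ≤ fsize A
sizeOrBodies≤fsize true  A = ≤-refl
sizeOrBodies≤fsize false A = boxBodiesᴸ≤fsize A

boxBodiesᴸ≤sizeOrBodies : ∀ b A → boxBodiesᴸ A ≤ sizeOrBodies b A
boxBodiesᴸ≤sizeOrBodies true  A = boxBodiesᴸ≤fsize A
boxBodiesᴸ≤sizeOrBodies false A = ≤-refl

sizeIf≤sizeOrBodies : ∀ b A → sizeIf b A ≤ sizeOrBodies b A
sizeIf≤sizeOrBodies true  A = ≤-refl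
sizeIf≤sizeOrBodies false A = z≤n

sizeOrBodies-mono : ∀ b b' {A F} → (b ≡ true → b' ≡ true) → boxBodiesᴸ A ≤ boxBodiesᴸ F → fsize A ≤ fsize F →
  sizeOrBodies b A ≤ sizeOrBodies b' F
sizeOrBodies-mono true  b' imp _ le rewrite imp refl = le
sizeOrBodies-mono false b' {F = F} imp le _ = ≤-trans le (boxBodiesᴸ≤sizeOrBodies b' F)

sizeOrBodies-+ : ∀ b b' {A B F} → fsize A + fsize B ≤ fsize F → boxBodiesᴸ A + boxBodiesᴸ B ≤ boxBodiesᴸ F →
  sizeOrBodies b A + sizeOrBodies b' B ≤ sizeOrBodies (b ∨ b') F
sizeOrBodies-+ true  b' {A} le _ = ≤-trans (+-monoʳ-≤ (fsize A) (sizeOrBodies≤fsize b' _)) le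
sizeOrBodies-+ false true {A} {B} le _ = ≤-trans (+-monoˡ-≤ (fsize B) (boxBodiesᴸ≤fsize A)) le
sizeOrBodies-+ false false _ le = le

-- A formula with a ⟨⟩ that (→⟨⟩) may introduce can come to stand next to the contents of a
-- bracket that rule strips; its mergeSize is its size. Inside a bracket a formula is measured by
-- innerSize: fully if it can merge, otherwise by what ([]⁻¹→) can release from it.
innerSize mergeSizeᴸ mergeSizeᴿ : Fm → ℕ
innerSize  A = sizeOrBodies (negDia A) A
mergeSizeᴸ A = sizeIf (negDia A) A
mergeSizeᴿ A = sizeIf (posDia A) A

mergeSizeᴿ≤fsize : ∀ A → mergeSizeᴿ A ≤ fsize A
mergeSizeᴿ≤fsize A = sizeIf≤fsize (posDia A) A

fsize≤innerSize-box : ∀ A → fsize A ≤ innerSize (box A)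
fsize≤innerSize-box A with negDia A
... | true  = n≤1+n (fsize A)
... | false = ≤-refl

innerSizes mergeSizes : MF → ℕ
innerSizes = weight innerSize 0
mergeSizes = weight mergeSizeᴸ 0

levelSize : MF → ℕ
levelSize []         = 0
levelSize (fm A ∷ Π) = fsize A + levelSize Π
levelSize (br Γ ∷ Π) = innerSizes Γ + levelSize Π

levelSize-++ : Additive levelSize
levelSize-++ []         M = refl
levelSize-++ (fm A ∷ L) M = trans (cong (fsize A +_) (levelSize-++ L M)) (sym (+-assoc (fsize A) _ _))
levelSize-++ (br Γ ∷ L) M = trans (cong (innerSizes Γ +_) (levelSize-++ L M)) (sym (+-assoc (innerSizes Γ) _ _))

mergeSizes≤innerSizes : ∀ Π → mergeSizes Π ≤ innerSizes Π
mergeSizes≤innerSizes = weight-mono 0 (λ A → sizeIf≤sizeOrBodies (negDia A) A)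

innerSizes≤levelSize : ∀ Π → innerSizes Π ≤ levelSize Π
innerSizes≤levelSize []         = z≤n
innerSizes≤levelSize (fm A ∷ Π) = +-mono-≤ (sizeOrBodies≤fsize (negDia A) A) (innerSizes≤levelSize Π)
innerSizes≤levelSize (br Γ ∷ Π) = +-monoʳ-≤ (innerSizes Γ) (innerSizes≤levelSize Π)

mergeSizes≤levelSize : ∀ Π → mergeSizes Π ≤ levelSize Π
mergeSizes≤levelSize Π = ≤-trans (mergeSizes≤innerSizes Π) (innerSizes≤levelSize Π)

levelSize≤mfsize : ∀ Π → levelSize Π ≤ mfsize Π
levelSize≤mfsize []         = z≤n
levelSize≤mfsize (fm A ∷ Π) = +-monoʳ-≤ (fsize A) (levelSize≤mfsize Π)
levelSize≤mfsize (br Γ ∷ Π) =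
  m≤n⇒m≤o+n 2 (+-mono-≤ (≤-trans (innerSizes≤levelSize Γ) (levelSize≤mfsize Γ)) (levelSize≤mfsize Π))

mergeSizes≤mfsize : ∀ Π → mergeSizes Π ≤ mfsize Π
mergeSizes≤mfsize Π = ≤-trans (mergeSizes≤levelSize Π) (levelSize≤mfsize Π)

-- BracketsFit K t Π: every bracket [ Γ ] of Π, at any depth, has levelSize Γ plus the mergeSizes
-- of everything around it (t accumulating those of the enclosing levels) at most K, since by
-- (→⟨⟩) its contents may reach the top level together with a subformula of those.
Fits : ℕ → ℕ → ℕ → MF → Set
BracketsFit : ℕ → ℕ → MF → Set
Fits K f t Π = (levelSize Π + f ≤ K) × BracketsFit K t Π
BracketsFit K t []         = ⊤
BracketsFit K t (fm A ∷ Π) = BracketsFit K (t + mergeSizeᴸ A) Π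
BracketsFit K t (br Γ ∷ Π) = Fits K (t + mergeSizes Π) (t + mergeSizes Π) Γ × BracketsFit K (t + mergeSizes Γ) Π

module _ {K : ℕ} where

  Fits-anti : ∀ {f f' t t'} Π → f' ≤ f → t' ≤ t → Fits K f t Π → Fits K f' t' Π
  BracketsFit-anti : ∀ {t t'} Π → t' ≤ t → BracketsFit K t Π → BracketsFit K t' Π
  Fits-anti Π f'≤f t'≤t (bound , fit) = ≤-trans (+-monoʳ-≤ (levelSize Π) f'≤f) bound , BracketsFit-anti Π t'≤t fit
  BracketsFit-anti []         le fit = tt
  BracketsFit-anti (fm A ∷ Π) le fit = BracketsFit-anti Π (+-monoˡ-≤ (mergeSizeᴸ A) le) fit
  BracketsFit-anti (br Γ ∷ Π) le (inner , fit) =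
    Fits-anti Γ (+-monoˡ-≤ (mergeSizes Π) le) (+-monoˡ-≤ (mergeSizes Π) le) inner ,
    BracketsFit-anti Π (+-monoˡ-≤ (mergeSizes Γ) le) fit

  private
    BracketsFit-≡ : ∀ {t t'} Π → t ≡ t' → BracketsFit K t Π → BracketsFit K t' Π
    BracketsFit-≡ Π refl fit = fit

    Fits-≡ : ∀ {a a'} Π → a ≡ a' → Fits K a a Π → Fits K a' a' Π
    Fits-≡ Π refl fit = fit

  BracketsFit-++⁻ : ∀ {t} L R → BracketsFit K t (L ++ R) →
    BracketsFit K (t + mergeSizes R) L × BracketsFit K (t + mergeSizes L) R
  BracketsFit-++⁻ {t} [] R fit = tt , BracketsFit-≡ R (sym (+-identityʳ t)) fit
  BracketsFit-++⁻ {t} (fm A ∷ L) R fit =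
    BracketsFit-≡ L (xy∙z≈xz∙y t _ _) (proj₁ split) , BracketsFit-≡ R (+-assoc t (mergeSizeᴸ A) _) (proj₂ split)
    where split = BracketsFit-++⁻ L R fit
  BracketsFit-++⁻ {t} (br Γ ∷ L) R (inner , fit) =
    (Fits-≡ Γ outside inner , BracketsFit-≡ L (xy∙z≈xz∙y t _ _) (proj₁ split)) ,
    BracketsFit-≡ R (+-assoc t (mergeSizes Γ) _) (proj₂ split)
    where
    split = BracketsFit-++⁻ L R fit
    outside : t + mergeSizes (L ++ R) ≡ t + mergeSizes R + mergeSizes L
    outside = trans (cong (t +_) (trans (weight-++ mergeSizeᴸ 0 L R) (+-comm (mergeSizes L) _))) (sym (+-assoc t _ _))

  BracketsFit-++⁺ : ∀ {t} L R → BracketsFit K (t + mergeSizes R) L → BracketsFit K (t + mergeSizes L) R →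
    BracketsFit K t (L ++ R)
  BracketsFit-++⁺ {t} [] R fitL fitR = BracketsFit-≡ R (+-identityʳ t) fitR
  BracketsFit-++⁺ {t} (fm A ∷ L) R fitL fitR =
    BracketsFit-++⁺ L R (BracketsFit-≡ L (xy∙z≈xz∙y t _ _) fitL) (BracketsFit-≡ R (sym (+-assoc t (mergeSizeᴸ A) _)) fitR)
  BracketsFit-++⁺ {t} (br Γ ∷ L) R (inner , fitL) fitR =
    Fits-≡ Γ outside inner ,
    BracketsFit-++⁺ L R (BracketsFit-≡ L (xy∙z≈xz∙y t _ _) fitL) (BracketsFit-≡ R (sym (+-assoc t (mergeSizes Γ) _)) fitR)
    where
    outside : t + mergeSizes R + mergeSizes L ≡ t + mergeSizes (L ++ R)
    outside = trans (+-assoc t _ _) (cong (t +_) (trans (+-comm (mergeSizes R) _) (sym (weight-++ mergeSizeᴸ 0 L R))))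

record Shrinks (K : ℕ) (X X' : MF) : Set where
  field
    levelSize≤  : levelSize X' ≤ levelSize X
    innerSizes≤ : innerSizes X' ≤ innerSizes X
    mergeSizes≤ : mergeSizes X' ≤ mergeSizes X
    bracketsFit : ∀ t → levelSize X + t ≤ K → BracketsFit K t X → BracketsFit K t X'

module _ {K : ℕ} where

  levelSize-plug-≤ : ∀ Δ {X X'} → Shrinks K X X' → levelSize (plug Δ X') ≤ levelSize (plug Δ X)
  levelSize-plug-≤ (top L R) {X} {X'} sh
    rewrite levelSize-++ L (X' ++ R) | levelSize-++ X' R | levelSize-++ L (X ++ R) | levelSize-++ X R =
      +-monoʳ-≤ (levelSize L) (+-monoˡ-≤ (levelSize R) (Shrinks.levelSize≤ sh))
  levelSize-plug-≤ (nest L C R) {X} {X'} sh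
    rewrite levelSize-++ L (br (plug C X') ∷ R) | levelSize-++ L (br (plug C X) ∷ R) =
      +-monoʳ-≤ (levelSize L) (+-monoˡ-≤ (levelSize R) (weight-plug-≤ innerSize 0 C (Shrinks.innerSizes≤ sh)))

  fits-middle : ∀ {f t} L X R → t ≤ f → Fits K f t (L ++ (X ++ R)) →
    Fits K (t + mergeSizes L + mergeSizes R) (t + mergeSizes L + mergeSizes R) X
  fits-middle {f} {t} L X R t≤f (bound , fit) = room , proj₁ (BracketsFit-++⁻ X R (proj₂ (BracketsFit-++⁻ L (X ++ R) fit)))
    where
    open ≤-Reasoning
    room : levelSize X + (t + mergeSizes L + mergeSizes R) ≤ K
    room = begin
      levelSize X + (t + mergeSizes L + mergeSizes R)
        ≤⟨ +-monoʳ-≤ (levelSize X) (+-mono-≤ (+-mono-≤ t≤f (mergeSizes≤levelSize L)) (mergeSizes≤levelSize R)) ⟩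
      levelSize X + (f + levelSize L + levelSize R)
        ≡⟨ shuffle (levelSize X) f (levelSize L) (levelSize R) ⟩
      levelSize L + (levelSize X + levelSize R) + f
        ≡⟨ cong (_+ f) (sym (trans (levelSize-++ L (X ++ R)) (cong (levelSize L +_) (levelSize-++ X R)))) ⟩
      levelSize (L ++ (X ++ R)) + f
        ≤⟨ bound ⟩
      K ∎
      where
      shuffle : ∀ x f l r → x + (f + l + r) ≡ l + (x + r) + f
      shuffle = solve-∀

  fits-focus : ∀ {f t} Δ X → t ≤ f → Fits K f t (plug Δ X) → Σ ℕ λ a → Fits K a a X
  fits-focus (top L R)    X t≤f fits = _ , fits-middle L X R t≤f fits
  fits-focus (nest L C R) X t≤f (_ , fit) =
    fits-focus C X ≤-refl (proj₁ (proj₂ (BracketsFit-++⁻ L (br (plug C X) ∷ R) fit)))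

  fits-plug : ∀ {f t} Δ {X X'} → Shrinks K X X' → t ≤ f → Fits K f t (plug Δ X) → Fits K f t (plug Δ X')
  fits-plug {f} {t} (top L R) {X} {X'} sh t≤f (bound , fit) =
    ≤-trans (+-monoˡ-≤ f (levelSize-plug-≤ (top L R) sh)) bound ,
    BracketsFit-++⁺ L (X' ++ R)
      (BracketsFit-anti L (+-monoʳ-≤ t (weight-plug-≤ mergeSizeᴸ 0 (top [] R) {X} {X'} w≤)) fitL)
      (BracketsFit-++⁺ X' R
        (Shrinks.bracketsFit sh _ (proj₁ (fits-middle L X R t≤f (bound , fit))) fitX)
        (BracketsFit-anti R (+-monoʳ-≤ (t + mergeSizes L) w≤) fitR))
    where
    w≤ = Shrinks.mergeSizes≤ sh
    fitL = proj₁ (BracketsFit-++⁻ L (X ++ R) fit)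
    fitX = proj₁ (BracketsFit-++⁻ X R (proj₂ (BracketsFit-++⁻ L (X ++ R) fit)))
    fitR = proj₂ (BracketsFit-++⁻ X R (proj₂ (BracketsFit-++⁻ L (X ++ R) fit)))
  fits-plug {f} {t} (nest L C R) {X} {X'} sh t≤f (bound , fit) =
    ≤-trans (+-monoˡ-≤ f (levelSize-plug-≤ (nest L C R) sh)) bound ,
    BracketsFit-++⁺ L (br (plug C X') ∷ R)
      (BracketsFit-anti L (+-monoʳ-≤ t (+-monoˡ-≤ (mergeSizes R) w≤)) fitL)
      (fits-plug C sh ≤-refl inner , BracketsFit-anti R (+-monoʳ-≤ (t + mergeSizes L) w≤) fitR)
    where
    w≤ = weight-plug-≤ mergeSizeᴸ 0 C (Shrinks.mergeSizes≤ sh)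
    fitL = proj₁ (BracketsFit-++⁻ L (br (plug C X) ∷ R) fit)
    inner = proj₁ (proj₂ (BracketsFit-++⁻ L (br (plug C X) ∷ R) fit))
    fitR = proj₂ (proj₂ (BracketsFit-++⁻ L (br (plug C X) ∷ R) fit))

-- Large enough to pay for the bracket created by (contr_b) together with 4 units per symbol of
-- the bangs it copies, whose levelSize is at most K by the budget.
price : ℕ → ℕ
price K = 4 * K + 10

potᴸ potᴿ : ℕ → Fm → ℕ
potᴸ c A = 4 * fsize A + c * removersᴸ A
potᴿ c A = 4 * fsize A + c * removersᴿ A

potentials bracketCost : ℕ → MF → ℕ
potentials c = weight (potᴸ c) 8
bracketCost c = weight (λ _ → 0) c

potential cost : ℕ → Seq → ℕ
potential c (Π ⇒ A) = potentials c Π + potᴿ c A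
cost c (Π ⇒ _) = bracketCost c Π

badness : Fm → ℕ
badness A = if posBad A then 1 else 0

badness≡0 : ∀ A → badness A ≡ 0 → posBad A ≡ false
badness≡0 A e with posBad A
... | false = refl

posBad≡false : ∀ A → posBad A ≡ false → badness A ≡ 0
posBad≡false A e rewrite e = refl

badBangs : MF → ℕ
badBangs = weight badness 0

NoBadBang : Seq → Set
NoBadBang (Π ⇒ A) = badBangs Π ≡ 0 × negBad A ≡ false

Budget : ℕ → Seq → Set
Budget K (Π ⇒ A) = Fits K (fsize A) (mergeSizeᴿ A) Π

Bounded : ℕ → Seq → ℕ → ℕ → Set
Bounded K s r p = NoBadBang s → Budget K s → r + cost (price K) s ≤ potential (price K) s + p

Drops : ℕ → Seq → Seq → Set
Drops c s' s = potential c s' + 2 + cost c s ≤ potential c s + cost c s'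

unary-step : ∀ {K s s' r p} → p ≤ 1 →
  (NoBadBang s → Budget K s → NoBadBang s' × Budget K s' × Drops (price K) s' s) →
  Bounded K s' r p → Bounded K s (suc r) 0
unary-step {K} {s} {s'} {r} {p} p≤1 preserve ih good budget with preserve good budget
... | good' , budget' , drop =
  +-cancelˡ-≤ (P' + n' + 1) _ _ (subst₂ _≤_ (lhs r n' P' n) (rhs P' n' P n) (+-mono-≤ ih' drop))
  where
  c = price K
  P = potential c s
  P' = potential c s'
  n = cost c s
  n' = cost c s'
  ih' : r + n' ≤ P' + 1
  ih' = ≤-trans (ih good' budget') (+-monoʳ-≤ P' p≤1)
  lhs : ∀ r n' P' n → (r + n') + (P' + 2 + n) ≡ (P' + n' + 1) + (suc r + n)
  lhs = solve-∀
  rhs : ∀ P' n' P n → (P' + 1) + (P + n') ≡ (P' + n' + 1) + (P + 0)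
  rhs = solve-∀

binary-step : ∀ {K s s₁ s₂ r₁ r₂ p₁ p₂} → p₁ ≤ 1 → p₂ ≤ 1 →
  (NoBadBang s → Budget K s → (NoBadBang s₁ × Budget K s₁) × (NoBadBang s₂ × Budget K s₂)) →
  potential (price K) s₁ + potential (price K) s₂ + 4 ≤ potential (price K) s →
  cost (price K) s ≤ cost (price K) s₁ + cost (price K) s₂ →
  Bounded K s₁ r₁ p₁ → Bounded K s₂ r₂ p₂ → Bounded K s (suc (r₁ + r₂)) 0
binary-step {K} {s} {s₁} {s₂} {r₁} {r₂} {p₁} {p₂} p₁≤1 p₂≤1 preserve pot≤ cost≤ ih₁ ih₂ good budget
  with preserve good budget
... | (good₁ , budget₁) , (good₂ , budget₂) = begin
  suc (r₁ + r₂) + cost c s                   ≤⟨ +-monoʳ-≤ (suc (r₁ + r₂)) cost≤ ⟩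
  suc (r₁ + r₂) + (cost c s₁ + cost c s₂)    ≡⟨ shuffle r₁ r₂ (cost c s₁) (cost c s₂) ⟩
  suc ((r₁ + cost c s₁) + (r₂ + cost c s₂))  ≤⟨ s≤s (+-mono-≤ (ih₁ good₁ budget₁) (ih₂ good₂ budget₂)) ⟩
  suc ((P₁ + p₁) + (P₂ + p₂))                ≤⟨ s≤s (+-mono-≤ (+-monoʳ-≤ P₁ p₁≤1) (+-monoʳ-≤ P₂ p₂≤1)) ⟩
  suc ((P₁ + 1) + (P₂ + 1))                  ≤⟨ ≤-reflexive (shuffle′ P₁ P₂) ⟩
  P₁ + P₂ + 3                                ≤⟨ +-monoʳ-≤ (P₁ + P₂) (n≤1+n 3) ⟩
  P₁ + P₂ + 4                                ≤⟨ pot≤ ⟩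
  potential c s                              ≡⟨ +-identityʳ _ ⟨
  potential c s + 0                          ∎
  where
  open ≤-Reasoning
  c = price K
  P₁ = potential c s₁
  P₂ = potential c s₂
  shuffle : ∀ r₁ r₂ n₁ n₂ → suc (r₁ + r₂) + (n₁ + n₂) ≡ suc ((r₁ + n₁) + (r₂ + n₂))
  shuffle = solve-∀
  shuffle′ : ∀ p₁ p₂ → suc ((p₁ + 1) + (p₂ + 1)) ≡ p₁ + p₂ + 3
  shuffle′ = solve-∀

drops-in-context : ∀ c Δ {X X'} D →
  potentials c X' + 2 + bracketCost c X ≤ potentials c X + bracketCost c X' →
  Drops c (plug Δ X' ⇒ D) (plug Δ X ⇒ D)
drops-in-context c Δ {X} {X'} D local
  rewrite weight-plug (potᴸ c) 8 Δ X' | weight-plug (potᴸ c) 8 Δ X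
        | weight-plug (λ _ → 0) c Δ X | weight-plug (λ _ → 0) c Δ X' =
  subst₂ _≤_ (shuffleˡ p d n (potentials c X') (bracketCost c X)) (shuffleʳ p d n (potentials c X) (bracketCost c X'))
    (+-monoʳ-≤ (p + d + n) local)
  where
  p = weightᶜ (potᴸ c) 8 Δ
  d = potᴿ c D
  n = weightᶜ (λ _ → 0) c Δ
  shuffleˡ : ∀ p d n a m → p + d + n + (a + 2 + m) ≡ p + a + d + 2 + (n + m)
  shuffleˡ = solve-∀
  shuffleʳ : ∀ p d n a m → p + d + n + (a + m) ≡ p + a + d + (n + m)
  shuffleʳ = solve-∀

record LeftStep (K : ℕ) (X X' : MF) : Set where
  field
    shrinks   : Shrinks K X X'
    staysGood : badBangs X' ≡ 0
    drops     : levelSize X ≤ K →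
                potentials (price K) X' + 2 + bracketCost (price K) X ≤ potentials (price K) X + bracketCost (price K) X'

left-step : ∀ {K r p} Δ {X X'} D → p ≤ 1 → (badBangs X ≡ 0 → LeftStep K X X') →
  Bounded K (plug Δ X' ⇒ D) r p → Bounded K (plug Δ X ⇒ D) (suc r) 0
left-step {K} Δ {X} {X'} D p≤1 step = unary-step {s = plug Δ X ⇒ D} {s' = plug Δ X' ⇒ D} p≤1 preserve
  where
  preserve : NoBadBang (plug Δ X ⇒ D) → Budget K (plug Δ X ⇒ D) →
    NoBadBang (plug Δ X' ⇒ D) × Budget K (plug Δ X' ⇒ D) × Drops (price K) (plug Δ X' ⇒ D) (plug Δ X ⇒ D)
  preserve (noBad , negD) budget =
    (weight-plug-0 _ 0 Δ X' (proj₁ noBadΔX) staysGood , negD) ,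
    fits-plug Δ shrinks (mergeSizeᴿ≤fsize D) budget ,
    drops-in-context (price K) Δ D (drops levelX≤K)
    where
    noBadΔX = weight-plug-≡0 _ 0 Δ X noBad
    open LeftStep (step (proj₂ noBadΔX))
    levelX≤K = m+n≤o⇒m≤o (levelSize X) (proj₁ (proj₂ (fits-focus Δ X (mergeSizeᴿ≤fsize D) budget)))

badBangs-[fm] : ∀ A → badBangs [ fm A ] ≡ 0 → posBad A ≡ false
badBangs-[fm] A e = badness≡0 A (trans (sym (weight-[fm] badness 0 A)) e)

prodL-step : ∀ {K} A B → badBangs [ fm (prod A B) ] ≡ 0 → LeftStep K [ fm (prod A B) ] (fm A ∷ fm B ∷ [])
prodL-step {K} A B good = record
  { shrinks = record
    { levelSize≤  = m+k≡n⇒m≤n 1 (sizes (fsize A) (fsize B))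
    ; innerSizes≤ = subst₂ _≤_ (sym (weight-[fm,fm] innerSize 0 A B)) (sym (weight-[fm] innerSize 0 (prod A B)))
                      (sizeOrBodies-+ (negDia A) (negDia B) {F = prod A B} (n≤1+n _) ≤-refl)
    ; mergeSizes≤ = subst₂ _≤_ (sym (weight-[fm,fm] mergeSizeᴸ 0 A B)) (sym (weight-[fm] mergeSizeᴸ 0 (prod A B)))
                      (sizeIf-+ (negDia A) (negDia B) {F = prod A B} (n≤1+n _))
    ; bracketsFit = λ _ _ _ → tt
    }
  ; staysGood = trans (weight-[fm,fm] badness 0 A B)
                  (cong₂ _+_ (posBad≡false A (∨-conicalˡ _ _ AB-good)) (posBad≡false B (∨-conicalʳ _ _ AB-good)))
  ; drops = λ _ → m+k≡n⇒m≤n 2 (potentials≡ (price K) (fsize A) (fsize B) (removersᴸ A) (removersᴸ B))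
  }
  where
  AB-good = badBangs-[fm] (prod A B) good
  sizes : ∀ a b → a + (b + 0) + 1 ≡ suc (a + b) + 0
  sizes = solve-∀
  potentials≡ : ∀ c a b ra rb → 4 * a + c * ra + (4 * b + c * rb + 0) + 2 + 0 + 2 ≡ 4 * suc (a + b) + c * (ra + rb) + 0 + 0
  potentials≡ = solve-∀

oneL-step : ∀ {K} → LeftStep K [ fm one ] []
oneL-step = record
  { shrinks   = record { levelSize≤ = z≤n ; innerSizes≤ = z≤n ; mergeSizes≤ = z≤n ; bracketsFit = λ _ _ _ → tt }
  ; staysGood = refl
  ; drops     = λ _ → s≤s (s≤s z≤n)
  }

bangL-step : ∀ {K} A → badBangs [ fm (bang A) ] ≡ 0 → LeftStep K [ fm (bang A) ] [ fm A ]
bangL-step {K} A good = record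
  { shrinks = record
    { levelSize≤  = +-monoˡ-≤ 0 (n≤1+n _)
    ; innerSizes≤ = +-monoˡ-≤ 0 (sizeOrBodies-mono (negDia A) (negDia A) {F = bang A} id ≤-refl (n≤1+n _))
    ; mergeSizes≤ = +-monoˡ-≤ 0 (sizeIf-mono (negDia A) (negDia A) {F = bang A} id (n≤1+n _))
    ; bracketsFit = λ _ _ _ → tt
    }
  ; staysGood = cong (_+ 0) (posBad≡false A (∨-conicalʳ _ _ (badBangs-[fm] (bang A) good)))
  ; drops     = λ _ → m+k≡n⇒m≤n 2 (potentials≡ (price K) (fsize A) (removersᴸ A))
  }
  where
  potentials≡ : ∀ c a ra → 4 * a + c * ra + 0 + 2 + 0 + 2 ≡ 4 * suc a + c * ra + 0 + 0
  potentials≡ = solve-∀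

diaL-step : ∀ {K} A → badBangs [ fm (dia A) ] ≡ 0 → LeftStep K [ fm (dia A) ] [ br [ fm A ] ]
diaL-step {K} A good = record
  { shrinks = record
    { levelSize≤  = +-monoˡ-≤ 0 (≤-trans (≤-reflexive (weight-[fm] innerSize 0 A)) (m≤n⇒m≤1+n (sizeOrBodies≤fsize _ A)))
    ; innerSizes≤ = +-monoˡ-≤ 0 (≤-trans (≤-reflexive (weight-[fm] innerSize 0 A))
                                   (sizeOrBodies-mono (negDia A) (negDia A) {F = dia A} id ≤-refl (n≤1+n _)))
    ; mergeSizes≤ = +-monoˡ-≤ 0 (≤-trans (≤-reflexive (weight-[fm] mergeSizeᴸ 0 A))
                                   (sizeIf-mono (negDia A) (negDia A) {F = dia A} id (n≤1+n _)))
    ; bracketsFit = λ t bound _ → (≤-trans (m+k≡n⇒m≤n 1 (sizes (fsize A) t)) bound , tt) , tt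
    }
  ; staysGood = trans (+-identityʳ _) good
  ; drops     = λ _ → m+k≡n⇒m≤n (4 * K + 4) (potentials≡ K (fsize A) (removersᴸ A))
  }
  where
  sizes : ∀ a t → a + 0 + (t + 0) + 1 ≡ suc a + 0 + t
  sizes = solve-∀
  potentials≡ : ∀ K a ra →
    8 + (4 * a + (4 * K + 10) * ra + 0) + 0 + 2 + 0 + (4 * K + 4) ≡
    4 * suc a + (4 * K + 10) * ra + 0 + ((4 * K + 10) + 0 + 0)
  potentials≡ = solve-∀

boxL-step : ∀ {K} A → badBangs [ br [ fm (box A) ] ] ≡ 0 → LeftStep K [ br [ fm (box A) ] ] [ fm A ]
boxL-step {K} A good = record
  { shrinks = record
    { levelSize≤  = +-monoˡ-≤ 0 (≤-trans (fsize≤innerSize-box A) (≤-reflexive (sym (+-identityʳ _))))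
    ; innerSizes≤ = +-monoˡ-≤ 0 (≤-trans (≤-trans (sizeOrBodies≤fsize _ A) (fsize≤innerSize-box A))
                                         (≤-reflexive (sym (+-identityʳ _))))
    ; mergeSizes≤ = +-monoˡ-≤ 0 (≤-trans (sizeIf-mono (negDia A) (negDia A) {F = box A} id (n≤1+n _))
                                         (≤-reflexive (sym (+-identityʳ _))))
    ; bracketsFit = λ _ _ _ → tt
    }
  ; staysGood = trans (sym (+-identityʳ _)) good
  ; drops     = λ _ → m+k≡n⇒m≤n 10 (potentials≡ (price K) (fsize A) (removersᴸ A))
  }
  where
  potentials≡ : ∀ c a ra → 4 * a + c * ra + 0 + 2 + (c + 0 + 0) + 10 ≡ 8 + (4 * suc a + c * suc ra + 0) + 0 + 0
  potentials≡ = solve-∀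

goodBang : ∀ A → posBad (bang A) ≡ false → posBox A ≡ false × negDia A ≡ false
goodBang A p = ∨-conicalˡ (posBox A) _ badA , ∨-conicalʳ (posBox A) _ badA
  where badA = ∨-conicalˡ (badBang A) (posBad A) p

innerSize-goodBang : ∀ A → posBad (bang A) ≡ false → innerSize (bang A) ≡ 0
innerSize-goodBang A p with goodBang A p
... | noBox , noDia rewrite noDia = boxBodiesᴸ≡0 A noBox

mergeSize-goodBang : ∀ A → posBad (bang A) ≡ false → mergeSizeᴸ (bang A) ≡ 0
mergeSize-goodBang A p rewrite proj₂ (goodBang A p) = refl

removers-goodBang : ∀ A → posBad (bang A) ≡ false → removersᴸ (bang A) ≡ 0
removers-goodBang A p = removersᴸ≡0 A (proj₁ (goodBang A p)) (proj₂ (goodBang A p))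

weight-goodBangs : ∀ {g} c → (∀ A → posBad (bang A) ≡ false → g (bang A) ≡ 0) →
  ∀ As → badBangs (bangs As) ≡ 0 → weight g c (bangs As) ≡ 0
weight-goodBangs c vanish []       e = refl
weight-goodBangs c vanish (A ∷ As) e =
  cong₂ _+_ (vanish A (badness≡0 (bang A) (m+n≡0⇒m≡0 _ e))) (weight-goodBangs c vanish As (m+n≡0⇒n≡0 _ e))

potentials-goodBangs : ∀ c As → badBangs (bangs As) ≡ 0 → potentials c (bangs As) ≡ 4 * levelSize (bangs As)
potentials-goodBangs c []       e = refl
potentials-goodBangs c (A ∷ As) e = begin
  4 * suc (fsize A) + c * removersᴸ (bang A) + potentials c (bangs As)
    ≡⟨ cong₂ (λ r p → 4 * suc (fsize A) + c * r + p) (removers-goodBang A goodA) (potentials-goodBangs c As e′) ⟩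
  4 * suc (fsize A) + c * 0 + 4 * levelSize (bangs As)
    ≡⟨ cong (λ z → 4 * suc (fsize A) + z + 4 * levelSize (bangs As)) (*-zeroʳ c) ⟩
  4 * suc (fsize A) + 0 + 4 * levelSize (bangs As)
    ≡⟨ cong (_+ 4 * levelSize (bangs As)) (+-identityʳ (4 * suc (fsize A))) ⟩
  4 * suc (fsize A) + 4 * levelSize (bangs As)
    ≡⟨ *-distribˡ-+ 4 (suc (fsize A)) (levelSize (bangs As)) ⟨
  4 * levelSize (bangs (A ∷ As)) ∎
  where
  open ≡-Reasoning
  goodA = badness≡0 (bang A) (m+n≡0⇒m≡0 _ e)
  e′ = m+n≡0⇒n≡0 (badness (bang A)) e

BracketsFit-bangs : ∀ {K t} As → BracketsFit K t (bangs As)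
BracketsFit-bangs []       = tt
BracketsFit-bangs (A ∷ As) = BracketsFit-bangs As

weight-null-++-br : ∀ g {c} bs X → weight g c bs ≡ 0 → weight g c (bs ++ [ br X ]) ≡ c + weight g c X + 0
weight-null-++-br g bs X e = trans (weight-++ g _ bs [ br X ]) (cong (_+ _) e)

contr-step : ∀ {K} As Γ → badBangs (bangs As ++ Γ) ≡ 0 →
  LeftStep K (bangs As ++ Γ) (bangs As ++ [ br (bangs As ++ Γ) ])
contr-step {K} As Γ good = record
  { shrinks = record
    { levelSize≤  = levelSize≤
    ; innerSizes≤ = ≤-reflexive (trans (weight-null-++-br innerSize bs X innerBs) (+-identityʳ _))
    ; mergeSizes≤ = ≤-reflexive (trans (weight-null-++-br mergeSizeᴸ bs X mergeBs) (+-identityʳ _))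
    ; bracketsFit = λ t bound fit →
        BracketsFit-++⁺ bs [ br X ] (BracketsFit-bangs As)
          (Fits-anti X (≤-reflexive (noMerge t)) (≤-reflexive (noMerge t)) (bound , fit) , tt)
    }
  ; staysGood = trans (weight-null-++-br badness bs X goodBs) (trans (+-identityʳ _) good)
  ; drops     = drops
  }
  where
  open ≤-Reasoning
  bs = bangs As
  X = bs ++ Γ
  c = price K
  goodBs : badBangs bs ≡ 0
  goodBs = m+n≡0⇒m≡0 _ (trans (sym (weight-++ badness 0 bs Γ)) good)
  innerBs : innerSizes bs ≡ 0
  innerBs = weight-goodBangs 0 innerSize-goodBang As goodBs
  mergeBs : mergeSizes bs ≡ 0
  mergeBs = weight-goodBangs 0 mergeSize-goodBang As goodBs
  noMerge : ∀ t → t + mergeSizes bs + 0 ≡ t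
  noMerge t = trans (+-identityʳ _) (trans (cong (t +_) mergeBs) (+-identityʳ t))
  levelSize≤ : levelSize (bs ++ [ br X ]) ≤ levelSize X
  levelSize≤ = begin
    levelSize (bs ++ [ br X ])     ≡⟨ levelSize-++ bs [ br X ] ⟩
    levelSize bs + (innerSizes X + 0) ≡⟨ cong (levelSize bs +_) (trans (+-identityʳ _)
                                          (trans (weight-++ innerSize 0 bs Γ) (cong (_+ _) innerBs))) ⟩
    levelSize bs + innerSizes Γ    ≤⟨ +-monoʳ-≤ (levelSize bs) (innerSizes≤levelSize Γ) ⟩
    levelSize bs + levelSize Γ     ≡⟨ levelSize-++ bs Γ ⟨
    levelSize X                    ∎
  drops : levelSize X ≤ K → potentials c (bs ++ [ br X ]) + 2 + bracketCost c X ≤ potentials c X + bracketCost c (bs ++ [ br X ])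
  drops X≤K
    rewrite weight-++ (potᴸ c) 8 bs [ br X ] | potentials-goodBangs c As goodBs
          | weight-null-++-br (λ _ → 0) {c} bs X (weight-goodBangs c (λ _ _ → refl) As goodBs) = begin
    4 * levelSize bs + (8 + potentials c X + 0) + 2 + bracketCost c X ≡⟨ shuffle (levelSize bs) (potentials c X) (bracketCost c X) ⟩
    potentials c X + bracketCost c X + 10 + 4 * levelSize bs
      ≤⟨ +-monoʳ-≤ (potentials c X + bracketCost c X + 10) (*-monoʳ-≤ 4 bs≤K) ⟩
    potentials c X + bracketCost c X + 10 + 4 * K                   ≡⟨ shuffle′ K (potentials c X) (bracketCost c X) ⟩
    potentials c X + ((4 * K + 10) + bracketCost c X + 0)           ∎
    where
    bs≤K = ≤-trans (m≤m+n (levelSize bs) (levelSize Γ)) (≤-trans (≤-reflexive (sym (levelSize-++ bs Γ))) X≤K)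
    shuffle : ∀ v p n → 4 * v + (8 + p + 0) + 2 + n ≡ p + n + 10 + 4 * v
    shuffle = solve-∀
    shuffle′ : ∀ K p n → p + n + 10 + 4 * K ≡ p + ((4 * K + 10) + n + 0)
    shuffle′ = solve-∀

rdivR-step : ∀ {K r p} Γ B C → p ≤ 1 → Bounded K (Γ ++ [ fm B ] ⇒ C) r p → Bounded K (Γ ⇒ rdiv C B) (suc r) 0
rdivR-step {K} Γ B C p≤1 = unary-step {s = Γ ⇒ rdiv C B} {s' = Γ ++ [ fm B ] ⇒ C} p≤1 preserve
  where
  c = price K
  preserve : NoBadBang (Γ ⇒ rdiv C B) → Budget K (Γ ⇒ rdiv C B) →
    NoBadBang (Γ ++ [ fm B ] ⇒ C) × Budget K (Γ ++ [ fm B ] ⇒ C) × Drops c (Γ ++ [ fm B ] ⇒ C) (Γ ⇒ rdiv C B)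
  preserve (noBad , negF) (bound , fit) =
    (trans (weight-++ badness 0 Γ [ fm B ]) (cong₂ _+_ noBad (cong (_+ 0) (posBad≡false B (∨-conicalʳ _ _ negF)))) ,
     ∨-conicalˡ _ _ negF) ,
    (≤-trans (≤-reflexive (cong (_+ fsize C) (levelSize-++ Γ [ fm B ])))
             (≤-trans (m+k≡n⇒m≤n 1 (sizes (levelSize Γ) (fsize B) (fsize C))) bound) ,
     BracketsFit-++⁺ Γ [ fm B ] (BracketsFit-anti Γ merge≤ fit) tt) ,
    drop
    where
    sizes : ∀ v b c → v + (b + 0) + c + 1 ≡ v + suc (c + b)
    sizes = solve-∀
    merge≤ : mergeSizeᴿ C + (mergeSizeᴸ B + 0) ≤ mergeSizeᴿ (rdiv C B)
    merge≤ = ≤-trans (≤-reflexive (cong (mergeSizeᴿ C +_) (+-identityʳ _)))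
                     (sizeIf-+ (posDia C) (negDia B) {F = rdiv C B} (n≤1+n _))
    drop : Drops c (Γ ++ [ fm B ] ⇒ C) (Γ ⇒ rdiv C B)
    drop = m+k≡n⇒m≤n 2 (begin
      potentials c (Γ ++ [ fm B ]) + potᴿ c C + 2 + bracketCost c Γ + 2
        ≡⟨ cong (λ x → x + potᴿ c C + 2 + bracketCost c Γ + 2) (weight-++ (potᴸ c) 8 Γ [ fm B ]) ⟩
      potentials c Γ + (potᴸ c B + 0) + potᴿ c C + 2 + bracketCost c Γ + 2
        ≡⟨ potentials≡ c (potentials c Γ) (bracketCost c Γ) (fsize B) (fsize C) (removersᴸ B) (removersᴿ C) ⟩
      potentials c Γ + potᴿ c (rdiv C B) + (bracketCost c Γ + 0)
        ≡⟨ cong (potentials c Γ + potᴿ c (rdiv C B) +_) (weight-++ (λ _ → 0) c Γ [ fm B ]) ⟨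
      potentials c Γ + potᴿ c (rdiv C B) + bracketCost c (Γ ++ [ fm B ]) ∎)
      where
      open ≡-Reasoning
      potentials≡ : ∀ c P N b cc rb rc →
        P + (4 * b + c * rb + 0) + (4 * cc + c * rc) + 2 + N + 2 ≡ P + (4 * suc (cc + b) + c * (rc + rb)) + (N + 0)
      potentials≡ = solve-∀

ldivR-step : ∀ {K r p} Γ A C → p ≤ 1 → Bounded K (fm A ∷ Γ ⇒ C) r p → Bounded K (Γ ⇒ ldiv A C) (suc r) 0
ldivR-step {K} Γ A C p≤1 = unary-step {s = Γ ⇒ ldiv A C} {s' = fm A ∷ Γ ⇒ C} p≤1 preserve
  where
  c = price K
  preserve : NoBadBang (Γ ⇒ ldiv A C) → Budget K (Γ ⇒ ldiv A C) →
    NoBadBang (fm A ∷ Γ ⇒ C) × Budget K (fm A ∷ Γ ⇒ C) × Drops c (fm A ∷ Γ ⇒ C) (Γ ⇒ ldiv A C)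
  preserve (noBad , negF) (bound , fit) =
    (cong₂ _+_ (posBad≡false A (∨-conicalˡ _ _ negF)) noBad , ∨-conicalʳ _ _ negF) ,
    (≤-trans (m+k≡n⇒m≤n 1 (sizes (levelSize Γ) (fsize A) (fsize C))) bound ,
     BracketsFit-anti Γ (≤-trans (≤-reflexive (+-comm (mergeSizeᴿ C) _))
                                 (sizeIf-+ (negDia A) (posDia C) {F = ldiv A C} (n≤1+n _))) fit) ,
    m+k≡n⇒m≤n 2 (potentials≡ c (potentials c Γ) (bracketCost c Γ) (fsize A) (fsize C) (removersᴸ A) (removersᴿ C))
    where
    sizes : ∀ v a c → a + v + c + 1 ≡ v + suc (a + c)
    sizes = solve-∀
    potentials≡ : ∀ c P N a cc ra rc →
      4 * a + c * ra + P + (4 * cc + c * rc) + 2 + N + 2 ≡ P + (4 * suc (a + cc) + c * (ra + rc)) + N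
    potentials≡ = solve-∀

bangR-step : ∀ {K r p} Π A → p ≤ 1 → Bounded K (Π ⇒ A) r p → Bounded K (Π ⇒ bang A) (suc r) 0
bangR-step {K} Π A p≤1 = unary-step {s = Π ⇒ bang A} {s' = Π ⇒ A} p≤1 λ good budget →
  good ,
  Fits-anti Π (n≤1+n _) (sizeIf-mono (posDia A) (posDia A) {F = bang A} id (n≤1+n _)) budget ,
  m+k≡n⇒m≤n 2 (potentials≡ (price K) (potentials (price K) Π) (bracketCost (price K) Π) (fsize A) (removersᴿ A))
  where
  potentials≡ : ∀ c P N a ra → P + (4 * a + c * ra) + 2 + N + 2 ≡ P + (4 * suc a + c * ra) + N
  potentials≡ = solve-∀

diaR-step : ∀ {K r p} Π A → p ≤ 1 → Bounded K (Π ⇒ A) r p → Bounded K ([ br Π ] ⇒ dia A) (suc r) 0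
diaR-step {K} Π A p≤1 = unary-step {s = [ br Π ] ⇒ dia A} {s' = Π ⇒ A} p≤1 preserve
  where
  potentials≡ : ∀ c P N a ra → P + (4 * a + c * ra) + 2 + (c + N + 0) + 10 ≡ 8 + P + 0 + (4 * suc a + c * suc ra) + N
  potentials≡ = solve-∀
  preserve : NoBadBang ([ br Π ] ⇒ dia A) → Budget K ([ br Π ] ⇒ dia A) →
    NoBadBang (Π ⇒ A) × Budget K (Π ⇒ A) × Drops (price K) (Π ⇒ A) ([ br Π ] ⇒ dia A)
  preserve (noBad , negF) (_ , inner , _) =
    (m+n≡0⇒m≡0 _ noBad , negF) ,
    Fits-anti Π (m≤n⇒m≤n+o 0 (n≤1+n (fsize A))) (m≤n⇒m≤n+o 0 (m≤n⇒m≤1+n (mergeSizeᴿ≤fsize A))) inner ,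
    m+k≡n⇒m≤n 10 (potentials≡ (price K) (potentials (price K) Π) (bracketCost (price K) Π) (fsize A) (removersᴿ A))

boxR-step : ∀ {K r p} Π A → p ≤ 1 → Bounded K ([ br Π ] ⇒ A) r p → Bounded K (Π ⇒ box A) (suc r) 0
boxR-step {K} Π A p≤1 = unary-step {s = Π ⇒ box A} {s' = [ br Π ] ⇒ A} p≤1 preserve
  where
  potentials≡ : ∀ K P N a ra →
    8 + P + 0 + (4 * a + (4 * K + 10) * ra) + 2 + N + (4 * K + 4) ≡ P + (4 * suc a + (4 * K + 10) * ra) + ((4 * K + 10) + N + 0)
  potentials≡ = solve-∀
  preserve : NoBadBang (Π ⇒ box A) → Budget K (Π ⇒ box A) →
    NoBadBang ([ br Π ] ⇒ A) × Budget K ([ br Π ] ⇒ A) × Drops (price K) ([ br Π ] ⇒ A) (Π ⇒ box A)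
  preserve (noBad , negF) (bound , fit) =
    (trans (+-identityʳ _) noBad , negF) ,
    (≤-trans (+-mono-≤ (≤-trans (≤-reflexive (+-identityʳ _)) (innerSizes≤levelSize Π)) (n≤1+n _)) bound ,
     Fits-anti Π (≤-trans (≤-reflexive (+-identityʳ _)) (m≤n⇒m≤1+n (mergeSizeᴿ≤fsize A)))
                 (≤-trans (≤-reflexive (+-identityʳ _)) (sizeIf-mono (posDia A) (posDia A) {F = box A} id (n≤1+n _)))
                 (bound , fit) ,
     tt) ,
    m+k≡n⇒m≤n (4 * K + 4) (potentials≡ K (potentials (price K) Π) (bracketCost (price K) Π) (fsize A) (removersᴿ A))

prodR-step : ∀ {K r₁ r₂ p₁ p₂} Γ₁ Γ₂ A B → p₁ ≤ 1 → p₂ ≤ 1 →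
  Bounded K (Γ₁ ⇒ A) r₁ p₁ → Bounded K (Γ₂ ⇒ B) r₂ p₂ → Bounded K (Γ₁ ++ Γ₂ ⇒ prod A B) (suc (r₁ + r₂)) 0
prodR-step {K} Γ₁ Γ₂ A B p₁≤1 p₂≤1 =
  binary-step {s = Γ₁ ++ Γ₂ ⇒ prod A B} {s₁ = Γ₁ ⇒ A} {s₂ = Γ₂ ⇒ B} p₁≤1 p₂≤1 preserve
    (≤-reflexive (trans (potentials≡ c (potentials c Γ₁) (potentials c Γ₂) (fsize A) (fsize B) (removersᴿ A) (removersᴿ B))
                        (cong (_+ potᴿ c (prod A B)) (sym (weight-++ (potᴸ c) 8 Γ₁ Γ₂)))))
    (≤-reflexive (weight-++ (λ _ → 0) c Γ₁ Γ₂))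
  where
  c = price K
  potentials≡ : ∀ c P₁ P₂ a b ra rb →
    P₁ + (4 * a + c * ra) + (P₂ + (4 * b + c * rb)) + 4 ≡ P₁ + P₂ + (4 * suc (a + b) + c * (ra + rb))
  potentials≡ = solve-∀
  preserve : NoBadBang (Γ₁ ++ Γ₂ ⇒ prod A B) → Budget K (Γ₁ ++ Γ₂ ⇒ prod A B) →
    (NoBadBang (Γ₁ ⇒ A) × Budget K (Γ₁ ⇒ A)) × (NoBadBang (Γ₂ ⇒ B) × Budget K (Γ₂ ⇒ B))
  preserve (noBad , negF) (bound , fit) =
    ((m+n≡0⇒m≡0 _ noBad′ , ∨-conicalˡ _ _ negF) ,
     ≤-trans (m+k≡n⇒m≤n (levelSize Γ₂ + fsize B + 1) (sizes₁ (levelSize Γ₁) (levelSize Γ₂) (fsize A) (fsize B))) bound′ ,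
     BracketsFit-anti Γ₁ (≤-trans (sizeIf-mono (posDia A) (posDia A ∨ posDia B) {F = prod A B} (∨-trueˡ _)
                                               (m≤n⇒m≤1+n (m≤m+n _ _))) (m≤m+n _ _))
                         (proj₁ (BracketsFit-++⁻ Γ₁ Γ₂ fit))) ,
    ((m+n≡0⇒n≡0 _ noBad′ , ∨-conicalʳ _ _ negF) ,
     ≤-trans (m+k≡n⇒m≤n (levelSize Γ₁ + fsize A + 1) (sizes₂ (levelSize Γ₁) (levelSize Γ₂) (fsize A) (fsize B))) bound′ ,
     BracketsFit-anti Γ₂ (≤-trans (sizeIf-mono (posDia B) (posDia A ∨ posDia B) {F = prod A B} (∨-trueʳ _)
                                               (m≤n⇒m≤1+n (m≤n+m _ _))) (m≤m+n _ _))
                         (proj₂ (BracketsFit-++⁻ Γ₁ Γ₂ fit)))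
    where
    noBad′ = trans (sym (weight-++ badness 0 Γ₁ Γ₂)) noBad
    bound′ = ≤-trans (≤-reflexive (cong (_+ fsize (prod A B)) (sym (levelSize-++ Γ₁ Γ₂)))) bound
    sizes₁ : ∀ v₁ v₂ a b → v₁ + a + (v₂ + b + 1) ≡ v₁ + v₂ + suc (a + b)
    sizes₁ = solve-∀
    sizes₂ : ∀ v₁ v₂ a b → v₂ + b + (v₁ + a + 1) ≡ v₁ + v₂ + suc (a + b)
    sizes₂ = solve-∀

-- F acts, as an antecedent formula, like an implication with argument B and value C:
-- the rules (/→) and (\→) send B to the succedent of one premise and keep C in the other.
record Implication (F B C : Fm) : Set where
  field
    good           : posBad F ≡ false → negBad B ≡ false × posBad C ≡ false
    argument-size  : fsize B ≤ fsize F
    argument-merge : mergeSizeᴿ B ≤ mergeSizeᴸ F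
    value-size     : fsize C ≤ fsize F
    value-inner    : innerSize C ≤ innerSize F
    value-merge    : mergeSizeᴸ C ≤ mergeSizeᴸ F
    potential-split : ∀ c → potᴿ c B + potᴸ c C + 4 ≤ potᴸ c F

rdiv-implication : ∀ C B → Implication (rdiv C B) B C
rdiv-implication C B = record
  { good            = λ p → ∨-conicalʳ (posBad C) _ p , ∨-conicalˡ _ _ p
  ; argument-size   = m≤n⇒m≤1+n (m≤n+m _ _)
  ; argument-merge  = sizeIf-mono (posDia B) (negDia C ∨ posDia B) {F = rdiv C B} (∨-trueʳ _) (m≤n⇒m≤1+n (m≤n+m _ _))
  ; value-size      = m≤n⇒m≤1+n (m≤m+n _ _)
  ; value-inner     = sizeOrBodies-mono (negDia C) (negDia C ∨ posDia B) {F = rdiv C B} (∨-trueˡ _)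
                        (m≤m+n _ _) (m≤n⇒m≤1+n (m≤m+n _ _))
  ; value-merge     = sizeIf-mono (negDia C) (negDia C ∨ posDia B) {F = rdiv C B} (∨-trueˡ _) (m≤n⇒m≤1+n (m≤m+n _ _))
  ; potential-split = λ c → ≤-reflexive (potentials≡ c (fsize B) (fsize C) (removersᴿ B) (removersᴸ C))
  }
  where
  potentials≡ : ∀ c b cc rb rc → 4 * b + c * rb + (4 * cc + c * rc) + 4 ≡ 4 * suc (cc + b) + c * (rc + rb)
  potentials≡ = solve-∀

ldiv-implication : ∀ A C → Implication (ldiv A C) A C
ldiv-implication A C = record
  { good            = λ p → ∨-conicalˡ _ _ p , ∨-conicalʳ (negBad A) _ p
  ; argument-size   = m≤n⇒m≤1+n (m≤m+n _ _)
  ; argument-merge  = sizeIf-mono (posDia A) (posDia A ∨ negDia C) {F = ldiv A C} (∨-trueˡ _) (m≤n⇒m≤1+n (m≤m+n _ _))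
  ; value-size      = m≤n⇒m≤1+n (m≤n+m _ _)
  ; value-inner     = sizeOrBodies-mono (negDia C) (posDia A ∨ negDia C) {F = ldiv A C} (∨-trueʳ _)
                        (m≤n+m _ _) (m≤n⇒m≤1+n (m≤n+m _ _))
  ; value-merge     = sizeIf-mono (negDia C) (posDia A ∨ negDia C) {F = ldiv A C} (∨-trueʳ _) (m≤n⇒m≤1+n (m≤n+m _ _))
  ; potential-split = λ c → ≤-reflexive (potentials≡ c (fsize A) (fsize C) (removersᴿ A) (removersᴸ C))
  }
  where
  potentials≡ : ∀ c a cc ra rc → 4 * a + c * ra + (4 * cc + c * rc) + 4 ≡ 4 * suc (a + cc) + c * (ra + rc)
  potentials≡ = solve-∀

weight-member : ∀ g c L F R → g F ≤ weight g c (L ++ fm F ∷ R)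
weight-member g c L F R =
  ≤-trans (m≤m+n (g F) _) (≤-trans (m≤n+m _ (weight g c L)) (≤-reflexive (sym (weight-++ g c L (fm F ∷ R)))))

levelSize-member : ∀ L F R → fsize F ≤ levelSize (L ++ fm F ∷ R)
levelSize-member L F R =
  ≤-trans (m≤m+n (fsize F) _) (≤-trans (m≤n+m _ (levelSize L)) (≤-reflexive (sym (levelSize-++ L (fm F ∷ R)))))

implication-step : ∀ {K r₁ r₂ p₁ p₂ F B C} → Implication F B C → ∀ Δ L R D → p₁ ≤ 1 → p₂ ≤ 1 →
  Bounded K (L ++ R ⇒ B) r₁ p₁ → Bounded K (plug Δ [ fm C ] ⇒ D) r₂ p₂ →
  Bounded K (plug Δ (L ++ fm F ∷ R) ⇒ D) (suc (r₁ + r₂)) 0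
implication-step {K} {F = F} {B} {C} imp Δ L R D p₁≤1 p₂≤1 =
  binary-step {s = plug Δ X ⇒ D} {s₁ = L ++ R ⇒ B} {s₂ = plug Δ [ fm C ] ⇒ D} p₁≤1 p₂≤1 preserve pot≤ cost≤
  where
  open Implication imp
  c = price K
  X = L ++ fm F ∷ R

  shrinks : Shrinks K X [ fm C ]
  shrinks = record
    { levelSize≤  = ≤-trans (≤-reflexive (+-identityʳ _)) (≤-trans value-size (levelSize-member L F R))
    ; innerSizes≤ = ≤-trans (≤-reflexive (+-identityʳ _)) (≤-trans value-inner (weight-member innerSize 0 L F R))
    ; mergeSizes≤ = ≤-trans (≤-reflexive (+-identityʳ _)) (≤-trans value-merge (weight-member mergeSizeᴸ 0 L F R))
    ; bracketsFit = λ _ _ _ → tt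
    }

  argument-budget : ∀ a → Fits K a a X → Budget K (L ++ R ⇒ B)
  argument-budget a (bound , fit) =
    ≤-trans bound′ bound ,
    BracketsFit-++⁺ L R
      (BracketsFit-anti L (≤-trans (+-monoˡ-≤ (mergeSizes R) argument-merge) (m≤n+m _ a)) (proj₁ split))
      (BracketsFit-anti R (≤-trans (+-monoˡ-≤ (mergeSizes L) argument-merge)
                          (≤-trans (≤-reflexive (+-comm (mergeSizeᴸ F) _))
                          (≤-trans (m≤n+m _ a) (≤-reflexive (sym (+-assoc a _ _)))))) (proj₂ split))
    where
    open ≤-Reasoning
    split = BracketsFit-++⁻ L (fm F ∷ R) fit
    bound′ : levelSize (L ++ R) + fsize B ≤ levelSize X + a
    bound′ = begin
      levelSize (L ++ R) + fsize B             ≡⟨ cong (_+ fsize B) (levelSize-++ L R) ⟩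
      levelSize L + levelSize R + fsize B      ≤⟨ +-monoʳ-≤ (levelSize L + levelSize R) argument-size ⟩
      levelSize L + levelSize R + fsize F      ≡⟨ shuffle (levelSize L) (levelSize R) (fsize F) ⟩
      levelSize L + (fsize F + levelSize R)    ≡⟨ levelSize-++ L (fm F ∷ R) ⟨
      levelSize X                              ≤⟨ m≤m+n (levelSize X) a ⟩
      levelSize X + a                          ∎
      where
      shuffle : ∀ l r f → l + r + f ≡ l + (f + r)
      shuffle = solve-∀

  preserve : NoBadBang (plug Δ X ⇒ D) → Budget K (plug Δ X ⇒ D) →
    (NoBadBang (L ++ R ⇒ B) × Budget K (L ++ R ⇒ B)) × (NoBadBang (plug Δ [ fm C ] ⇒ D) × Budget K (plug Δ [ fm C ] ⇒ D))
  preserve (noBad , negD) budget =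
    ((trans (weight-++ badness 0 L R) (cong₂ _+_ (m+n≡0⇒m≡0 (badBangs L) noBadX) (m+n≡0⇒n≡0 (badness F) noBadFR)) ,
      proj₁ (good posF)) ,
     argument-budget _ (proj₂ (fits-focus Δ X (mergeSizeᴿ≤fsize D) budget))) ,
    ((weight-plug-0 badness 0 Δ [ fm C ] (proj₁ noBadΔX) (cong (_+ 0) (posBad≡false C (proj₂ (good posF)))) , negD) ,
     fits-plug Δ shrinks (mergeSizeᴿ≤fsize D) budget)
    where
    noBadΔX = weight-plug-≡0 badness 0 Δ X noBad
    noBadX : badBangs L + (badness F + badBangs R) ≡ 0
    noBadX = trans (sym (weight-++ badness 0 L (fm F ∷ R))) (proj₂ noBadΔX)
    noBadFR = m+n≡0⇒n≡0 (badBangs L) noBadX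
    posF = badness≡0 F (m+n≡0⇒m≡0 _ noBadFR)

  pot≤ : potential c (L ++ R ⇒ B) + potential c (plug Δ [ fm C ] ⇒ D) + 4 ≤ potential c (plug Δ X ⇒ D)
  pot≤ = begin
    potentials c (L ++ R) + potᴿ c B + (potentials c (plug Δ [ fm C ]) + d) + 4
      ≡⟨ cong₂ (λ x y → x + potᴿ c B + (y + d) + 4) (weight-++ (potᴸ c) 8 L R) (weight-plug (potᴸ c) 8 Δ [ fm C ]) ⟩
    pL + pR + potᴿ c B + (pΔ + (potᴸ c C + 0) + d) + 4
      ≡⟨ shuffle pL pR (potᴿ c B) pΔ (potᴸ c C) d ⟩
    pΔ + (pL + ((potᴿ c B + potᴸ c C + 4) + pR)) + d
      ≤⟨ +-monoˡ-≤ d (+-monoʳ-≤ pΔ (+-monoʳ-≤ pL (+-monoˡ-≤ pR (potential-split c)))) ⟩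
    pΔ + (pL + (potᴸ c F + pR)) + d
      ≡⟨ cong (λ z → pΔ + z + d) (weight-++ (potᴸ c) 8 L (fm F ∷ R)) ⟨
    pΔ + potentials c X + d
      ≡⟨ cong (_+ d) (weight-plug (potᴸ c) 8 Δ X) ⟨
    potentials c (plug Δ X) + d ∎
    where
    open ≤-Reasoning
    d = potᴿ c D
    pΔ = weightᶜ (potᴸ c) 8 Δ
    pL = potentials c L
    pR = potentials c R
    shuffle : ∀ l r b δ v d → l + r + b + (δ + (v + 0) + d) + 4 ≡ δ + (l + ((b + v + 4) + r)) + d
    shuffle = solve-∀

  cost≤ : cost c (plug Δ X ⇒ D) ≤ cost c (L ++ R ⇒ B) + cost c (plug Δ [ fm C ] ⇒ D)
  cost≤ = ≤-reflexive (begin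
    bracketCost c (plug Δ X)          ≡⟨ weight-plug (λ _ → 0) c Δ X ⟩
    nΔ + bracketCost c X              ≡⟨ cong (nΔ +_) (weight-++ (λ _ → 0) c L (fm F ∷ R)) ⟩
    nΔ + (nL + nR)                    ≡⟨ shuffle nΔ nL nR ⟩
    (nL + nR) + (nΔ + 0)              ≡⟨ cong₂ _+_ (weight-++ (λ _ → 0) c L R) (weight-plug (λ _ → 0) c Δ [ fm C ]) ⟨
    bracketCost c (L ++ R) + bracketCost c (plug Δ [ fm C ]) ∎)
    where
    open ≡-Reasoning
    nΔ = weightᶜ (λ _ → 0) c Δ
    nL = bracketCost c L
    nR = bracketCost c R
    shuffle : ∀ δ l r → δ + (l + r) ≡ (l + r) + (δ + 0)
    shuffle = solve-∀

rdivL-step : ∀ {K r₁ r₂ p₁ p₂} Γ B Δ C D → p₁ ≤ 1 → p₂ ≤ 1 →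
  Bounded K (Γ ⇒ B) r₁ p₁ → Bounded K (plug Δ [ fm C ] ⇒ D) r₂ p₂ →
  Bounded K (plug Δ (fm (rdiv C B) ∷ Γ) ⇒ D) (suc (r₁ + r₂)) 0
rdivL-step Γ B Δ C D = implication-step (rdiv-implication C B) Δ [] Γ D

ldivL-step : ∀ {K r₁ r₂ p₁ p₂} Γ A Δ C D → p₁ ≤ 1 → p₂ ≤ 1 →
  Bounded K (Γ ⇒ A) r₁ p₁ → Bounded K (plug Δ [ fm C ] ⇒ D) r₂ p₂ →
  Bounded K (plug Δ (Γ ++ [ fm (ldiv A C) ]) ⇒ D) (suc (r₁ + r₂)) 0
ldivL-step {K} {r₁} {p₁ = p₁} Γ A Δ C D p₁≤1 p₂≤1 ih₁ =
  implication-step (ldiv-implication A C) Δ Γ [] D p₁≤1 p₂≤1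
    (subst (λ Π → Bounded K (Π ⇒ A) r₁ p₁) (sym (++-identityʳ Γ)) ih₁)

mergeSizes-dropFm : ∀ L F R → mergeSizeᴸ F ≡ 0 → mergeSizes (L ++ fm F ∷ R) ≡ mergeSizes (L ++ R)
mergeSizes-dropFm L F R e rewrite weight-++ mergeSizeᴸ 0 L (fm F ∷ R) | weight-++ mergeSizeᴸ 0 L R | e = refl

module _ {K : ℕ} {F : Fm} (noMerge : mergeSizeᴸ F ≡ 0) where

  BracketsFit-dropFm : ∀ {t} L R → BracketsFit K t (L ++ fm F ∷ R) → BracketsFit K t (L ++ R)
  BracketsFit-dropFm {t} [] R fit = subst (λ u → BracketsFit K u R) (trans (cong (t +_) noMerge) (+-identityʳ t)) fit
  BracketsFit-dropFm (fm A ∷ L) R fit = BracketsFit-dropFm L R fit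
  BracketsFit-dropFm {t} (br Γ ∷ L) R (inner , fit) =
    subst (λ u → Fits K (t + u) (t + u) Γ) (mergeSizes-dropFm L F R noMerge) inner , BracketsFit-dropFm L R fit

  BracketsFit-addFm : ∀ {t} L R → BracketsFit K t (L ++ R) → BracketsFit K t (L ++ fm F ∷ R)
  BracketsFit-addFm {t} [] R fit = subst (λ u → BracketsFit K u R) (sym (trans (cong (t +_) noMerge) (+-identityʳ t))) fit
  BracketsFit-addFm (fm A ∷ L) R fit = BracketsFit-addFm L R fit
  BracketsFit-addFm {t} (br Γ ∷ L) R (inner , fit) =
    subst (λ u → Fits K (t + u) (t + u) Γ) (sym (mergeSizes-dropFm L F R noMerge)) inner , BracketsFit-addFm L R fit

NoMergeBangs : List (Fm × MF) → Set
NoMergeBangs ps = All (λ A → mergeSizeᴸ (bang A) ≡ 0) (map proj₁ ps)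

noMergeBangs : ∀ Δ₀ ps → badBangs (weave Δ₀ ps) ≡ 0 → NoMergeBangs ps
noMergeBangs Δ₀ []             e = []
noMergeBangs Δ₀ ((A , Δ) ∷ ps) e =
  mergeSize-goodBang A (badness≡0 (bang A) (m+n≡0⇒m≡0 _ rest)) ∷ noMergeBangs Δ ps (m+n≡0⇒n≡0 (badness (bang A)) rest)
  where
  rest = m+n≡0⇒n≡0 (badBangs Δ₀) (trans (sym (weight-++ badness 0 Δ₀ (fm (bang A) ∷ weave Δ ps))) e)

module _ {K : ℕ} where

  BracketsFit-unweave : ∀ {t} L Δ₀ ps → NoMergeBangs ps →
    BracketsFit K t (L ++ weave Δ₀ ps) → BracketsFit K t (L ++ (Δ₀ ++ concat (map proj₂ ps)))
  BracketsFit-unweave {t} L Δ₀ [] [] fit = subst (λ Δ → BracketsFit K t (L ++ Δ)) (sym (++-identityʳ Δ₀)) fit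
  BracketsFit-unweave {t} L Δ₀ ((A , Δ) ∷ ps) (noMerge ∷ noMerges) fit =
    subst (BracketsFit K t) (++-assoc L Δ₀ _)
      (BracketsFit-unweave (L ++ Δ₀) Δ ps noMerges
        (BracketsFit-dropFm noMerge (L ++ Δ₀) (weave Δ ps) (subst (BracketsFit K t) (sym (++-assoc L Δ₀ _)) fit)))

  BracketsFit-weave : ∀ {t} L Δ₀ ps → NoMergeBangs ps →
    BracketsFit K t (L ++ (Δ₀ ++ concat (map proj₂ ps))) → BracketsFit K t (L ++ weave Δ₀ ps)
  BracketsFit-weave {t} L Δ₀ [] [] fit = subst (λ Δ → BracketsFit K t (L ++ Δ)) (++-identityʳ Δ₀) fit
  BracketsFit-weave {t} L Δ₀ ((A , Δ) ∷ ps) (noMerge ∷ noMerges) fit =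
    subst (BracketsFit K t) (++-assoc L Δ₀ _)
      (BracketsFit-addFm noMerge (L ++ Δ₀) (weave Δ ps)
        (BracketsFit-weave (L ++ Δ₀) Δ ps noMerges (subst (BracketsFit K t) (sym (++-assoc L Δ₀ _)) fit)))

weight-plug-perm : ∀ g c Ξ Δ₀ ps qs → map proj₂ qs ≡ map proj₂ ps → map proj₁ qs ↭ map proj₁ ps →
  weight g c (plug Ξ (weave Δ₀ qs)) ≡ weight g c (plug Ξ (weave Δ₀ ps))
weight-plug-perm g c Ξ Δ₀ ps qs slots bangs↭ =
  trans (weight-plug g c Ξ _)
    (trans (cong (weightᶜ g c Ξ +_) (additive-perm (weight g c) (weight-++ g c) Δ₀ ps qs slots bangs↭)) (sym (weight-plug g c Ξ _)))

perm-step : ∀ {K r} Ξ Δ₀ ps qs C → map proj₂ qs ≡ map proj₂ ps → map proj₁ qs ↭ map proj₁ ps →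
  Bounded K (plug Ξ (weave Δ₀ ps) ⇒ C) r 0 → Bounded K (plug Ξ (weave Δ₀ qs) ⇒ C) (suc r) 1
perm-step {K} {r} Ξ Δ₀ ps qs C slots bangs↭ ih (noBad , negC) budget = begin
  suc r + cost c (plug Ξ X ⇒ C)    ≡⟨ cong (suc r +_) (same (λ _ → 0) c) ⟨
  suc (r + cost c (plug Ξ X' ⇒ C)) ≡⟨ +-comm 1 _ ⟩
  r + cost c (plug Ξ X' ⇒ C) + 1   ≤⟨ +-monoˡ-≤ 1 (ih noBad′ budget′) ⟩
  potential c (plug Ξ X' ⇒ C) + 0 + 1 ≡⟨ cong (λ x → x + potᴿ c C + 0 + 1) (same (potᴸ c) 8) ⟩
  potential c (plug Ξ X ⇒ C) + 0 + 1  ≡⟨ cong (_+ 1) (+-identityʳ _) ⟩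
  potential c (plug Ξ X ⇒ C) + 1 ∎
  where
  open ≤-Reasoning
  c = price K
  X = weave Δ₀ qs
  X' = weave Δ₀ ps
  same : ∀ g k → weight g k (plug Ξ X') ≡ weight g k (plug Ξ X)
  same g k = sym (weight-plug-perm g k Ξ Δ₀ ps qs slots bangs↭)
  noBad′ : NoBadBang (plug Ξ X' ⇒ C)
  noBad′ = trans (same badness 0) noBad , negC
  goodX = proj₂ (weight-plug-≡0 badness 0 Ξ X noBad)
  goodX' = proj₂ (weight-plug-≡0 badness 0 Ξ X' (proj₁ noBad′))
  unchanged : ∀ F → Additive F → F X' ≤ F X
  unchanged F F-++ = ≤-reflexive (sym (additive-perm F F-++ Δ₀ ps qs slots bangs↭))
  budget′ : Budget K (plug Ξ X' ⇒ C)
  budget′ = fits-plug Ξ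
    (record
      { levelSize≤  = unchanged levelSize levelSize-++
      ; innerSizes≤ = unchanged innerSizes (weight-++ innerSize 0)
      ; mergeSizes≤ = unchanged mergeSizes (weight-++ mergeSizeᴸ 0)
      ; bracketsFit = λ t _ fit →
          BracketsFit-weave [] Δ₀ ps (noMergeBangs Δ₀ ps goodX')
            (subst (λ Δs → BracketsFit K t (Δ₀ ++ concat Δs)) slots
              (BracketsFit-unweave [] Δ₀ qs (noMergeBangs Δ₀ qs goodX) fit))
      })
    (mergeSizeᴿ≤fsize C) budget

permSlack : ∀ {s} → Deriv s → ℕ
permSlack d = if isPerm d then 1 else 0

permSlack≤1 : ∀ {s} (d : Deriv s) → permSlack d ≤ 1
permSlack≤1 d with isPerm d
... | true  = ≤-refl
... | false = z≤n

private
  T-∧ˡ : ∀ {a b} → T (a ∧ b) → T a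
  T-∧ˡ t = proj₁ (Equivalence.to T-∧ t)

  T-∧ʳ : ∀ {a b} → T (a ∧ b) → T b
  T-∧ʳ t = proj₂ (Equivalence.to T-∧ t)

-- A (perm)* step is paid for by the slack, which is available because normality forbids its
-- premise to be another (perm)* step.
rules-bounded : ∀ K {s} (d : Deriv s) → T (CutFree d) → T (Normal d) → Bounded K s (rules d) (permSlack d)
rules-bounded K (ax A) _ _ _ _ = z≤n
rules-bounded K ax1    _ _ _ _ = z≤n
rules-bounded K (rdivL Γ B Δ C D d e) cf nf =
  rdivL-step Γ B Δ C D (permSlack≤1 d) (permSlack≤1 e)
    (rules-bounded K d (T-∧ˡ cf) (T-∧ˡ nf)) (rules-bounded K e (T-∧ʳ cf) (T-∧ʳ nf))
rules-bounded K (rdivR Γ B C d) cf nf = rdivR-step Γ B C (permSlack≤1 d) (rules-bounded K d cf nf)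
rules-bounded K (ldivL Γ A Δ C D d e) cf nf =
  ldivL-step Γ A Δ C D (permSlack≤1 d) (permSlack≤1 e)
    (rules-bounded K d (T-∧ˡ cf) (T-∧ˡ nf)) (rules-bounded K e (T-∧ʳ cf) (T-∧ʳ nf))
rules-bounded K (ldivR Γ A C d) cf nf = ldivR-step Γ A C (permSlack≤1 d) (rules-bounded K d cf nf)
rules-bounded K (prodL Δ A B D d) cf nf =
  left-step Δ D (permSlack≤1 d) (prodL-step A B) (rules-bounded K d cf nf)
rules-bounded K (prodR Γ₁ Γ₂ A B d e) cf nf =
  prodR-step Γ₁ Γ₂ A B (permSlack≤1 d) (permSlack≤1 e)
    (rules-bounded K d (T-∧ˡ cf) (T-∧ˡ nf)) (rules-bounded K e (T-∧ʳ cf) (T-∧ʳ nf))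
rules-bounded K (oneL Δ A d) cf nf =
  left-step Δ A (permSlack≤1 d) (λ _ → oneL-step) (rules-bounded K d cf nf)
rules-bounded K (diaL Δ A C d) cf nf =
  left-step Δ C (permSlack≤1 d) (diaL-step A) (rules-bounded K d cf nf)
rules-bounded K (diaR Π A d) cf nf = diaR-step Π A (permSlack≤1 d) (rules-bounded K d cf nf)
rules-bounded K (boxL Δ A C d) cf nf =
  left-step Δ C (permSlack≤1 d) (boxL-step A) (rules-bounded K d cf nf)
rules-bounded K (boxR Π A d) cf nf = boxR-step Π A (permSlack≤1 d) (rules-bounded K d cf nf)
rules-bounded K (bangL Δ A B d) cf nf =
  left-step Δ B (permSlack≤1 d) (bangL-step A) (rules-bounded K d cf nf)
rules-bounded K (bangR As A d) cf nf = bangR-step (bangs As) A (permSlack≤1 d) (rules-bounded K d cf nf)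
rules-bounded K (contr Δ A As Γ B d) cf nf =
  left-step Δ B (permSlack≤1 d) (contr-step (A ∷ As) Γ) (rules-bounded K d cf nf)
rules-bounded K (perm Ξ Δ₀ ps qs C slots bangs↭ d) cf nf =
  perm-step Ξ Δ₀ ps qs C slots bangs↭
    (subst (Bounded K (plug Ξ (weave Δ₀ ps) ⇒ C) (rules d)) premiseSlack (rules-bounded K d cf (T-∧ʳ nf)))
  where
  premiseSlack : permSlack d ≡ 0
  premiseSlack = cong (λ b → if b then 1 else 0) (Equivalence.to T-not-≡ (T-∧ˡ nf))
rules-bounded K (cut Π A Δ C d e) () nf

badBangs-antBad : ∀ Π → antBad Π ≡ false → badBangs Π ≡ 0
badBangs-antBad []         e = refl
badBangs-antBad (fm A ∷ Π) e = cong₂ _+_ (posBad≡false A (∨-conicalˡ _ _ e)) (badBangs-antBad Π (∨-conicalʳ _ _ e))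
badBangs-antBad (br Γ ∷ Π) e = cong₂ _+_ (badBangs-antBad Γ (∨-conicalˡ _ _ e)) (badBangs-antBad Π (∨-conicalʳ _ _ e))

noBadBang-initial : ∀ Π A → BracketNonNeg (Π ⇒ A) → NoBadBang (Π ⇒ A)
noBadBang-initial Π A nonNeg = badBangs-antBad Π (∨-conicalˡ _ _ bad) , ∨-conicalʳ (antBad Π) _ bad
  where bad = Equivalence.to T-not-≡ nonNeg

BracketsFit-initial : ∀ {K} t Π → t + mfsize Π ≤ K → BracketsFit K t Π
BracketsFit-initial t [] _ = tt
BracketsFit-initial t (fm A ∷ Π) room =
  BracketsFit-initial (t + mergeSizeᴸ A) Π
    (≤-trans (+-monoˡ-≤ (mfsize Π) (+-monoʳ-≤ t (sizeIf≤fsize (negDia A) A)))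
             (≤-trans (≤-reflexive (+-assoc t (fsize A) (mfsize Π))) room))
BracketsFit-initial t (br Γ ∷ Π) room =
  (≤-trans (+-mono-≤ (levelSize≤mfsize Γ) (+-monoʳ-≤ t (mergeSizes≤mfsize Π)))
           (≤-trans (m+k≡n⇒m≤n 2 (shuffle₁ t (mfsize Γ) (mfsize Π))) room) ,
   BracketsFit-initial (t + mergeSizes Π) Γ
     (≤-trans (+-monoˡ-≤ (mfsize Γ) (+-monoʳ-≤ t (mergeSizes≤mfsize Π)))
              (≤-trans (m+k≡n⇒m≤n 2 (shuffle₂ t (mfsize Γ) (mfsize Π))) room))) ,
  BracketsFit-initial (t + mergeSizes Γ) Π
    (≤-trans (+-monoˡ-≤ (mfsize Π) (+-monoʳ-≤ t (mergeSizes≤mfsize Γ)))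
             (≤-trans (m+k≡n⇒m≤n 2 (shuffle₃ t (mfsize Γ) (mfsize Π))) room))
  where
  shuffle₁ : ∀ t g p → g + (t + p) + 2 ≡ t + (2 + g + p)
  shuffle₁ = solve-∀
  shuffle₂ : ∀ t g p → t + p + g + 2 ≡ t + (2 + g + p)
  shuffle₂ = solve-∀
  shuffle₃ : ∀ t g p → t + g + p + 2 ≡ t + (2 + g + p)
  shuffle₃ = solve-∀

budget-initial : ∀ Π A → Budget (mfsize Π + fsize A) (Π ⇒ A)
budget-initial Π A =
  +-monoˡ-≤ (fsize A) (levelSize≤mfsize Π) ,
  BracketsFit-initial (mergeSizeᴿ A) Π (≤-trans (+-monoˡ-≤ (mfsize Π) (mergeSizeᴿ≤fsize A)) (≤-reflexive (+-comm (fsize A) _)))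

potᴸ≤ : ∀ c A → potᴸ c A ≤ (4 + c) * fsize A
potᴸ≤ c A = ≤-trans (+-monoʳ-≤ (4 * fsize A) (*-monoʳ-≤ c (removersᴸ≤fsize A))) (≤-reflexive (sym (*-distribʳ-+ (fsize A) 4 c)))

potᴿ≤ : ∀ c A → potᴿ c A ≤ (4 + c) * fsize A
potᴿ≤ c A = ≤-trans (+-monoʳ-≤ (4 * fsize A) (*-monoʳ-≤ c (removersᴿ≤fsize A))) (≤-reflexive (sym (*-distribʳ-+ (fsize A) 4 c)))

potentials≤ : ∀ c Π → potentials c Π ≤ (4 + c) * mfsize Π
potentials≤ c []         = z≤n
potentials≤ c (fm A ∷ Π) =
  ≤-trans (+-mono-≤ (potᴸ≤ c A) (potentials≤ c Π)) (≤-reflexive (sym (*-distribˡ-+ (4 + c) (fsize A) (mfsize Π))))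
potentials≤ c (br Γ ∷ Π) =
  ≤-trans (+-mono-≤ (+-monoʳ-≤ 8 (potentials≤ c Γ)) (potentials≤ c Π)) (m+k≡n⇒m≤n (2 * c) (expand c (mfsize Γ) (mfsize Π)))
  where
  expand : ∀ c g p → 8 + (4 + c) * g + (4 + c) * p + 2 * c ≡ (4 + c) * (2 + g + p)
  expand = solve-∀

rules-quadratic : ∀ {Π : MF} {A : Fm} (d : Deriv (Π ⇒ A)) → T (CutFree d) → T (Normal d) → BracketNonNeg (Π ⇒ A) →
  rules d ≤ 4 * size (Π ⇒ A) * size (Π ⇒ A) + 14 * size (Π ⇒ A) + 1
rules-quadratic {Π} {A} d cf nf nonNeg = begin
  rules d                                           ≤⟨ m≤m+n (rules d) _ ⟩
  rules d + cost c (Π ⇒ A)                          ≤⟨ rules-bounded K d cf nf (noBadBang-initial Π A nonNeg) (budget-initial Π A) ⟩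
  potential c (Π ⇒ A) + permSlack d                 ≤⟨ +-mono-≤ (+-mono-≤ (potentials≤ c Π) (potᴿ≤ c A)) (permSlack≤1 d) ⟩
  (4 + c) * mfsize Π + (4 + c) * fsize A + 1        ≡⟨ quadratic (mfsize Π) (fsize A) ⟩
  4 * K * K + 14 * K + 1
    ≤⟨ +-monoˡ-≤ 1 (+-mono-≤ (*-mono-≤ (*-monoʳ-≤ 4 K≤size) K≤size) (*-monoʳ-≤ 14 K≤size)) ⟩
  4 * size (Π ⇒ A) * size (Π ⇒ A) + 14 * size (Π ⇒ A) + 1 ∎
  where
  open ≤-Reasoning
  K = mfsize Π + fsize A
  c = price K
  K≤size : K ≤ size (Π ⇒ A)
  K≤size = +-monoʳ-≤ (mfsize Π) (n≤1+n (fsize A))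
  quadratic : ∀ m f → (4 + (4 * (m + f) + 10)) * m + (4 + (4 * (m + f) + 10)) * f + 1 ≡ 4 * (m + f) * (m + f) + 14 * (m + f) + 1
  quadratic = solve-∀

lemma9 : ∃ λ (a : ℕ) → ∃ λ (b : ℕ) → ∃ λ (c : ℕ) →
           ∀ {Π : MF} {A : Fm} (d : Deriv (Π ⇒ A)) →
           T (CutFree d) → T (Normal d) → BracketNonNeg (Π ⇒ A) →
           rules d ≤ a * size (Π ⇒ A) * size (Π ⇒ A) + b * size (Π ⇒ A) + c
lemma9 = 4 , 14 , 1 , rules-quadratic
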